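{- Let $\Psi\subset\Delta^+_\ell$ be a root ideal, $M$ a multiset on $[\ell]$, $\gamma\in\mathbb Z^\ell$, and $1\le x<y\le z\le\ell$ integers such that: (a) $\Psi$ has a ceiling in columns $z-1,z$, and $D^{z-1}_{x,y}\subset\Psi$ with every root of $D^{z-1}_{x,y}$ removable from $\Psi$; (b) $L(D^{z-1}_{x,y})\subset M$ and $m_M(z)=m_M(z-1)=m_M(z-2)+1=\cdots=m_M(y)+z-1-y$; (c) $\Psi$ has a wall in rows $y,y+1,\dots,z$; (d) $\gamma_y=\cdots=\gamma_z$. Then $K(\Psi;M;\gamma)=K(\Psi';M';\gamma)$, where $\Psi'=\Psi\setminus D^{z-1}_{x,y}$ and $M'=M\setminus L(D^{z-1}_{x,y})$.
   Context: $h_d$ complete homogeneous symmetric functions ($h_0=1$, $h_d=0$ for $d<0$); $k^{(r)}_m=\sum_{i=0}^m\binom{r+i-1}{i}h_{m-i}$; $g_\gamma=\det(k^{(i-1)}_{\gamma_i+j-i})_{1\le i,j\le\ell}$. $\Delta^+_\ell=\{(i,j):1\le i<j\le\ell\}$ viewed as cells (row $i$, column $j$); a root ideal is an upper order ideal for $(a,b)\le(c,d)\iff a\ge c,b\le d$; a root $\alpha\in\Psi$ is removable if $\Psi\setminus\alpha$ is a root ideal. $\Psi$ has a wall in rows $r,\dots,r+d$ if these rows of $\Psi$ contain the same number of roots, and a ceiling in columns $c,\dots,c+d$ if these columns contain the same number of roots. The diagonal $D^z_{x,y}=\{(i,j):j-i=y-x,\ y\le j\le z\}$. For a set $\mathcal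 D$ of roots, $L(\mathcal D)$ is the multiset $\bigsqcup_{(i,j)\in\mathcal D}\{j\}$; $m_M$ is the multiplicity function of a multiset $M$ supported in $[\ell]$, and $M\setminus L(\mathcal D)$ is multiset difference. $K(\Psi;M;\gamma)=g\big(\prod_{(a,b)\in\Psi}(1-z_a/z_b)^{ -1}\prod_{b\in M}(1-1/z_b)\mathbf z^\gamma\big)$, expanded in $\mathbb Z[[z_1/z_2,\dots,z_{\ell-1}/z_\ell]][z_1^{\pm1},\dots,z_\ell^{\pm1}]$ with $g:\mathbf z^\gamma\mapsto g_\gamma$ additive. -}

module Defs where

open import Level using (Level)
open import Data.Bool using (Bool; true; false; _∧_; not; if_then_else_)
import Data.Nat as N
open import Data.Nat using (ℕ; zero; suc; _+_; _∸_; _≤_; _<_; _≡ᵇ_; _≤ᵇ_; _<ᵇ_)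
open import Data.Nat.Combinatorics using (_C_)
open import Data.Integer as ℤ using (ℤ; +_; -[1+_])
open import Data.List using (List; []; _∷_; length; filterᵇ; concatMap; map; applyUpTo)
open import Data.Product using (_×_; _,_)
open import Relation.Binary.PropositionalEquality using (_≡_)
open import Algebra.Bundles using (CommutativeRing)

-- Combinatorics of root ideals in Δ⁺_ℓ (1-based indices, roots (i,j), 1 ≤ i < j ≤ ℓ)

interval : ℕ → ℕ → List ℕ
interval a b = applyUpTo (λ t → a + t) (suc b ∸ a)

RootSet : Set
RootSet = ℕ → ℕ → Bool

-- Ψ ⊂ Δ⁺_ℓ and Ψ is an upper order ideal for (a,b) ≤ (c,d) ⟺ a ≥ c, b ≤ d.
record IsRootIdeal (ℓ : ℕ) (Ψ : RootSet) : Set where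
  field
    inΔ⁺  : ∀ i j → Ψ i j ≡ true → (1 ≤ i) × (i < j) × (j ≤ ℓ)
    upper : ∀ a b c d → Ψ a b ≡ true → 1 ≤ c → c ≤ a → b ≤ d → d ≤ ℓ → Ψ c d ≡ true

removeRoot : ℕ → ℕ → RootSet → RootSet
removeRoot a b Ψ i j = Ψ i j ∧ not ((i ≡ᵇ a) ∧ (j ≡ᵇ b))

Removable : ℕ → RootSet → ℕ → ℕ → Set
Removable ℓ Ψ a b = IsRootIdeal ℓ (removeRoot a b Ψ)

rowCount : ℕ → RootSet → ℕ → ℕ
rowCount ℓ Ψ r = length (filterᵇ (λ j → Ψ r j) (interval 1 ℓ))

colCount : ℕ → RootSet → ℕ → ℕ
colCount ℓ Ψ c = length (filterᵇ (λ i → Ψ i c) (interval 1 ℓ))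

Wall : ℕ → RootSet → ℕ → ℕ → Set
Wall ℓ Ψ r s = ∀ t → r ≤ t → t ≤ s → rowCount ℓ Ψ t ≡ rowCount ℓ Ψ r

Ceiling : ℕ → RootSet → ℕ → ℕ → Set
Ceiling ℓ Ψ c d = ∀ t → c ≤ t → t ≤ d → colCount ℓ Ψ t ≡ colCount ℓ Ψ c

-- membership in the diagonal D^w_{x,y} = {(i,j) : j - i = y - x, y ≤ j ≤ w}
inDiag : ℕ → ℕ → ℕ → ℕ → ℕ → Bool
inDiag x y w i j = ((j + x) ≡ᵇ (i + y)) ∧ ((y ≤ᵇ j) ∧ (j ≤ᵇ w))

removeDiag : ℕ → ℕ → ℕ → RootSet → RootSet
removeDiag x y w Ψ i j = Ψ i j ∧ not (inDiag x y w i j)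

-- Multisets on [ℓ] are given by their multiplicity function m = m_M.

MultisetOn : ℕ → (ℕ → ℕ) → Set
MultisetOn ℓ m = ∀ b → (b ≡ 0 → m b ≡ 0) × (ℓ < b → m b ≡ 0)

-- multiplicity function of L(D^w_{x,y}) = ⊔_{(i,j) ∈ D} {j}, computed as
-- the number of roots of D^w_{x,y} in column j (rows i ∈ [1, ℓ])
multL : ℕ → ℕ → ℕ → ℕ → ℕ → ℕ
multL ℓ x y w j = length (filterᵇ (λ i → inDiag x y w i j) (interval 1 ℓ))

minusL : ℕ → ℕ → ℕ → ℕ → (ℕ → ℕ) → (ℕ → ℕ)
minusL ℓ x y w m j = m j ∸ multL ℓ x y w j

-- Symmetric-function side.  We work in an arbitrary commutative ring R
-- with an arbitrary sequence h : ℕ → R, h 0 = 1.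

module Sym {c r : Level} (R : CommutativeRing c r) (h : ℕ → CommutativeRing.Carrier R) where
  open CommutativeRing R renaming (_+_ to _⊕_; _*_ to _⊛_; -_ to ⊝_)

  sumR : ℕ → (ℕ → Carrier) → Carrier
  sumR zero    f = 0#
  sumR (suc n) f = sumR n f ⊕ f n

  natR : ℕ → Carrier
  natR zero    = 0#
  natR (suc n) = 1# ⊕ natR n

  sgn : ℕ → Carrier
  sgn zero    = 1#
  sgn (suc n) = ⊝ sgn n

  -- k^{(r)}_m = Σ_{i=0}^m binom(r+i-1, i) h_{m-i}; 0 for m < 0
  -- (binom(r+i-1,i) with r = i = 0 is binom(-1,0) = 1 = binom(0,0))
  kfun : ℕ → ℤ → Carrier
  kfun rr (+ n)    = sumR (suc n) (λ i → natR (((rr + i) ∸ 1) C i) ⊛ h (n ∸ i))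
  kfun rr -[1+ _ ] = 0#

  -- determinant of an n×n matrix (0-based entries A row col), Laplace expansion along row 0
  det : ℕ → (ℕ → ℕ → Carrier) → Carrier
  det zero    A = 1#
  det (suc n) A = sumR (suc n) (λ j → sgn j ⊛ (A 0 j ⊛ det n (λ rr cc → A (suc rr) (if cc <ᵇ j then cc else suc cc))))

  -- g_γ = det( k^{(i-1)}_{γ_i + j - i} )_{1 ≤ i,j ≤ ℓ}
  g : ℕ → (ℕ → ℤ) → Carrier
  g ℓ γ = det ℓ (λ rr cc → kfun rr ((γ (suc rr) ℤ.+ (+ cc)) ℤ.- (+ rr)))

  shift : (ℕ → ℤ) → ℕ → ℤ → (ℕ → ℤ)
  shift γ a d i = if i ≡ᵇ a then γ i ℤ.+ d else γ i

  rootsOf : ℕ → RootSet → List (ℕ × ℕ)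
  rootsOf ℓ Ψ = filterᵇ (λ p → Ψ (Data.Product.proj₁ p) (Data.Product.proj₂ p))
                  (concatMap (λ i → map (λ j → (i , j)) (interval (suc i) ℓ)) (interval 1 ℓ))

  -- expansion of ∏_{(a,b) ∈ roots} (1 - z_a/z_b)^{-1} = ∏ Σ_k (z_a/z_b)^k,
  -- truncated to exponents k ≤ N, applied to z^γ and then to the functional F
  raise : ℕ → List (ℕ × ℕ) → (ℕ → ℤ) → ((ℕ → ℤ) → Carrier) → Carrier
  raise N []             γ F = F γ
  raise N ((a , b) ∷ rs) γ F =
    sumR (suc N) (λ k → raise N rs (shift (shift γ a (+ k)) b (ℤ.- (+ k))) F)

  -- expansion of ∏_{b ∈ [bs]} (1 - 1/z_b)^{m(b)} applied to z^γ, then g applied (additively)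
  lower : ℕ → List ℕ → (ℕ → ℕ) → (ℕ → ℤ) → Carrier
  lower ℓ []       m γ = g ℓ γ
  lower ℓ (b ∷ bs) m γ =
    sumR (suc (m b)) (λ s → sgn s ⊛ (natR (m b C s) ⊛ lower ℓ bs m (shift γ b (ℤ.- (+ s)))))

  -- K_N(Ψ;M;γ): the series K(Ψ;M;γ) with each geometric series truncated at z^{kα}, k ≤ N.
  -- (Only finitely many terms are nonzero, so K(Ψ;M;γ) = K_N(Ψ;M;γ) for all large N.)
  Ktrunc : ℕ → ℕ → RootSet → (ℕ → ℕ) → (ℕ → ℤ) → Carrier
  Ktrunc ℓ N Ψ m γ = raise N (rootsOf ℓ Ψ) γ (lower ℓ (interval 1 ℓ) m)

-- The diagonal roots (x + s, y + s) are removed one at a time, starting next to column z.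
-- For a root (a, b), with b, b + 1 alike in Ψ (wall, ceiling, removability) and in M, peel one factor
-- (1 - 1/z_b) off M and expand the root's series as Σ_t z^{t(e_a - e_b)}. Since z^{-e_b} z^{t(e_a - e_b)}
-- = z^{-e_a} z^{(t+1)(e_a - e_b)}, the sum telescopes to K(Ψ ∖ (a, b); M ∖ {b}) plus a tail at t = N + 1,
-- which is 0 for large truncation N because g_β = 0 once β is too negative in columns b, …, ℓ, plus a
-- series K(Ψ; M ∖ {b} ⊔ {a}; γ + e_a - e_b) with m(b + 1) = m(b) + 1 and γ_b = γ_{b+1} - 1. That series is 0
-- by straightening: k^{(r)}_n - k^{(r)}_{n-1} = k^{(r-1)}_n turns g(1 - 1/z_{b+1}) into a determinant whose
-- rows b, b + 1 are interchanged by the involution (β_b, β_{b+1}) ↦ (β_{b+1} - 1, β_b + 1), so it is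
-- antisymmetric under it, while the remaining data are symmetric.

module Submission where

open import Defs
open import Level using (Level)
open import Function using (_∘_; id)
open import Function.Bundles using (Equivalence)
open import Data.Empty using (⊥; ⊥-elim)
open import Data.Bool using (Bool; true; false; _∧_; not; if_then_else_; T)
open import Data.Bool.Properties using (∧-zeroʳ; ∧-identityʳ; T-≡)
open import Data.Nat as ℕ using (ℕ; zero; suc; _+_; _∸_; _≤_; _<_; z≤n; s≤s; _≡ᵇ_; _<ᵇ_; _≤ᵇ_; _⊔_)
import Data.Nat.Properties as ℕₚ
open import Data.Nat.Combinatorics using (_C_; nCk+nC[k+1]≡[n+1]C[k+1]; k>n⇒nCk≡0)
open import Data.Integer as ℤ using (ℤ; +_; -[1+_]; 0ℤ; 1ℤ; -1ℤ)
import Data.Integer.Properties as ℤₚ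
import Algebra.Properties.CommutativeSemigroup ℤₚ.+-commutativeSemigroup as ℤ+ₚ
import Algebra.Properties.CommutativeSemigroup ℕₚ.+-commutativeSemigroup as ℕ+ₚ
open import Data.Integer.Tactic.RingSolver using (solve-∀)
open import Data.Product using (_×_; _,_; proj₁; proj₂; ∃)
open import Data.Sum using (_⊎_; inj₁; inj₂)
open import Data.List using (List; []; _∷_; [_]; _++_; map; concatMap; filterᵇ; length; applyUpTo)
import Data.List.Properties as Listₚ
open import Data.List.Membership.Propositional using (_∈_)
open import Data.List.Membership.Propositional.Properties using (∈-applyUpTo⁺; ∈-applyUpTo⁻; ∈-map⁻; ∈-++⁻; ∈-filter⁻)
open import Data.List.Relation.Unary.Any using (here; there)
open import Data.List.Relation.Unary.All as All using (All; []; _∷_)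
open import Data.List.Relation.Binary.Permutation.Propositional as ↭ using (_↭_)
import Data.List.Relation.Binary.Permutation.Propositional.Properties as ↭ₚ
open import Relation.Binary.PropositionalEquality as ≡ using (_≡_; _≢_; _≗_)
open import Relation.Binary.Definitions using (tri<; tri≈; tri>)
open import Relation.Nullary using (¬_; yes; no)
open import Relation.Nullary.Decidable using (T?; ⌊_⌋)
open import Algebra.Bundles using (CommutativeRing)

private
  variable
    A B : Set

≗-trans : {f g k : A → B} → f ≗ g → g ≗ k → f ≗ k
≗-trans f≗g g≗k x = ≡.trans (f≗g x) (g≗k x)

≡ᵇ-refl : ∀ n → (n ≡ᵇ n) ≡ true
≡ᵇ-refl zero    = ≡.refl
≡ᵇ-refl (suc n) = ≡ᵇ-refl n

≡ᵇ-true⇒≡ : ∀ {m n} → (m ≡ᵇ n) ≡ true → m ≡ n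
≡ᵇ-true⇒≡ {m} {n} e = ℕₚ.≡ᵇ⇒≡ m n (Equivalence.from T-≡ e)

≢⇒≡ᵇ-false : ∀ {m n} → m ≢ n → (m ≡ᵇ n) ≡ false
≢⇒≡ᵇ-false {m} {n} m≢n with m ≡ᵇ n in e
... | true  = ⊥-elim (m≢n (≡ᵇ-true⇒≡ e))
... | false = ≡.refl

≤⇒≤ᵇ-true : ∀ {m n} → m ≤ n → (m ≤ᵇ n) ≡ true
≤⇒≤ᵇ-true m≤n = Equivalence.to T-≡ (ℕₚ.≤⇒≤ᵇ m≤n)

≤ᵇ-true⇒≤ : ∀ {m n} → (m ≤ᵇ n) ≡ true → m ≤ n
≤ᵇ-true⇒≤ {m} {n} e = ℕₚ.≤ᵇ⇒≤ m n (Equivalence.from T-≡ e)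

<⇒<ᵇ-true : ∀ {m n} → m < n → (m <ᵇ n) ≡ true
<⇒<ᵇ-true m<n = Equivalence.to T-≡ (ℕₚ.<⇒<ᵇ m<n)

≥⇒<ᵇ-false : ∀ {m n} → n ≤ m → (m <ᵇ n) ≡ false
≥⇒<ᵇ-false {m} {n} n≤m with m <ᵇ n in e
... | true  = ⊥-elim (ℕₚ.<⇒≱ (ℕₚ.<ᵇ⇒< m n (Equivalence.from T-≡ e)) n≤m)
... | false = ≡.refl

false≢true : false ≢ true
false≢true ()

∧-true⇒trueˡ : ∀ {x y} → (x ∧ y) ≡ true → x ≡ true
∧-true⇒trueˡ {true} _ = ≡.refl

true⇔true⇒≡ : ∀ {x y : Bool} → (x ≡ true → y ≡ true) → (y ≡ true → x ≡ true) → x ≡ y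
true⇔true⇒≡ {true}  {true}  _ _ = ≡.refl
true⇔true⇒≡ {true}  {false} f _ = ≡.sym (f ≡.refl)
true⇔true⇒≡ {false} {true}  _ g = g ≡.refl
true⇔true⇒≡ {false} {false} _ _ = ≡.refl

applyUpTo-cong : ∀ {f g : ℕ → A} n → f ≗ g → applyUpTo f n ≡ applyUpTo g n
applyUpTo-cong zero    f≗g = ≡.refl
applyUpTo-cong (suc n) f≗g = ≡.cong₂ _∷_ (f≗g 0) (applyUpTo-cong n (f≗g ∘ suc))

applyUpTo-++ : ∀ (f : ℕ → A) k n → applyUpTo f (k + n) ≡ applyUpTo f k ++ applyUpTo (λ t → f (k + t)) n
applyUpTo-++ f zero    n = ≡.refl
applyUpTo-++ f (suc k) n = ≡.cong (f 0 ∷_) (applyUpTo-++ (f ∘ suc) k n)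

∈-interval⁺ : ∀ {a c j} → a ≤ j → j ≤ c → j ∈ interval a c
∈-interval⁺ {a} {c} a≤j j≤c =
  ≡.subst (_∈ interval a c) (ℕₚ.m+[n∸m]≡n a≤j) (∈-applyUpTo⁺ (λ t → a + t) (ℕₚ.∸-monoˡ-< (s≤s j≤c) a≤j))

∈-interval⁻ : ∀ {a c j} → j ∈ interval a c → a ≤ j × j ≤ c
∈-interval⁻ {a} {c} m with ∈-applyUpTo⁻ (λ t → a + t) m
... | t , t< , ≡.refl with a ℕ.≤? suc c
...   | yes a≤1+c = ℕₚ.m≤m+n a t , ℕₚ.≤-pred (≡.subst (a + t <_) (ℕₚ.m+[n∸m]≡n a≤1+c) (ℕₚ.+-monoʳ-< a t<))
...   | no  a≰1+c = ⊥-elim (ℕₚ.n≮0 (≡.subst (t <_) (ℕₚ.m≤n⇒m∸n≡0 (ℕₚ.<⇒≤ (ℕₚ.≰⇒> a≰1+c))) t<))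

interval-∷ : ∀ {a c} → a ≤ c → interval a c ≡ a ∷ interval (suc a) c
interval-∷ {a} {c} a≤c rewrite ℕₚ.+-∸-assoc 1 a≤c =
  ≡.cong₂ _∷_ (ℕₚ.+-identityʳ a) (applyUpTo-cong (c ∸ a) (ℕₚ.+-suc a))

interval-++ : ∀ {a b c} → a ≤ suc b → b ≤ c → interval a c ≡ interval a b ++ interval (suc b) c
interval-++ {a} {b} {c} a≤1+b b≤c = ≡.trans (≡.cong (applyUpTo (λ t → a + t)) length-split)
  (≡.trans (applyUpTo-++ (λ t → a + t) (suc b ∸ a) (c ∸ b))
    (≡.cong (interval a b ++_) (applyUpTo-cong (c ∸ b) λ t →
      ≡.trans (≡.sym (ℕₚ.+-assoc a (suc b ∸ a) t)) (≡.cong (_+ t) (ℕₚ.m+[n∸m]≡n a≤1+b)))))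
  where
  length-split : suc c ∸ a ≡ (suc b ∸ a) + (c ∸ b)
  length-split = ≡.trans (≡.cong (λ n → suc n ∸ a) (≡.sym (ℕₚ.m+[n∸m]≡n b≤c))) (ℕₚ.+-∸-comm (c ∸ b) a≤1+b)

interval-split : ∀ {a k c} → a ≤ k → k ≤ c → 1 ≤ k →
  interval a c ≡ interval a (ℕ.pred k) ++ k ∷ interval (suc k) c
interval-split {k = suc k} a≤k k≤c _ = ≡.trans (interval-++ a≤k (ℕₚ.<⇒≤ k≤c)) (≡.cong (interval _ k ++_) (interval-∷ k≤c))

∈-interval-pred⇒< : ∀ {a k x} → 1 ≤ k → x ∈ interval a (ℕ.pred k) → x < k
∈-interval-pred⇒< {k = suc k} _ m = s≤s (proj₂ (∈-interval⁻ m))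

filterᵇ-cong-local : ∀ {p q : A → Bool} xs → (∀ x → x ∈ xs → p x ≡ q x) → filterᵇ p xs ≡ filterᵇ q xs
filterᵇ-cong-local []       _   = ≡.refl
filterᵇ-cong-local {p = p} {q} (x ∷ xs) p≗q with p x | q x | p≗q x (here ≡.refl)
... | true  | true  | _ = ≡.cong (x ∷_) (filterᵇ-cong-local xs (λ y → p≗q y ∘ there))
... | false | false | _ = filterᵇ-cong-local xs (λ y → p≗q y ∘ there)

filterᵇ-none : ∀ {p : A → Bool} xs → (∀ x → x ∈ xs → p x ≡ false) → filterᵇ p xs ≡ []
filterᵇ-none []       _ = ≡.refl
filterᵇ-none {p = p} (x ∷ xs) ¬p with p x | ¬p x (here ≡.refl)
... | false | _ = filterᵇ-none xs (λ y → ¬p y ∘ there)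

filterᵇ-++ : ∀ (p : A → Bool) xs ys → filterᵇ p (xs ++ ys) ≡ filterᵇ p xs ++ filterᵇ p ys
filterᵇ-++ p = Listₚ.filter-++ (T? ∘ p)

filterᵇ-concatMap : ∀ (p : B → Bool) (f : A → List B) xs →
  filterᵇ p (concatMap f xs) ≡ concatMap (filterᵇ p ∘ f) xs
filterᵇ-concatMap p f []       = ≡.refl
filterᵇ-concatMap p f (x ∷ xs) =
  ≡.trans (filterᵇ-++ p (f x) (concatMap f xs)) (≡.cong (filterᵇ p (f x) ++_) (filterᵇ-concatMap p f xs))

filterᵇ-map : ∀ (p : B → Bool) (f : A → B) xs → filterᵇ p (map f xs) ≡ map f (filterᵇ (p ∘ f) xs)
filterᵇ-map p f []       = ≡.refl
filterᵇ-map p f (x ∷ xs) with p (f x)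
... | true  = ≡.cong (f x ∷_) (filterᵇ-map p f xs)
... | false = filterᵇ-map p f xs

filterᵇ-partition-↭ : ∀ (p q : A → Bool) xs →
  filterᵇ p xs ↭ filterᵇ (λ x → p x ∧ q x) xs ++ filterᵇ (λ x → p x ∧ not (q x)) xs
filterᵇ-partition-↭ p q []       = ↭.refl
filterᵇ-partition-↭ p q (x ∷ xs) with p x | q x
... | true  | true  = ↭.prep x (filterᵇ-partition-↭ p q xs)
... | true  | false = ↭.trans (↭.prep x (filterᵇ-partition-↭ p q xs)) (↭.↭-sym (↭ₚ.shift x _ _))
... | false | _     = filterᵇ-partition-↭ p q xs

∈-filterᵇ⁻ : ∀ {p : A → Bool} xs {x} → x ∈ filterᵇ p xs → p x ≡ true
∈-filterᵇ⁻ {p = p} xs m = Equivalence.to T-≡ (proj₂ (∈-filter⁻ (T? ∘ p) {xs = xs} m))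

length-filterᵇ-≤ : ∀ (p q : A → Bool) xs → (∀ x → x ∈ xs → q x ≡ true → p x ≡ true) →
  length (filterᵇ q xs) ≤ length (filterᵇ p xs)
length-filterᵇ-≤ p q []       _   = z≤n
length-filterᵇ-≤ p q (x ∷ xs) q⊆p with q x in qx | p x in px
... | true  | true  = s≤s (length-filterᵇ-≤ p q xs (λ y → q⊆p y ∘ there))
... | true  | false = ⊥-elim (false≢true (≡.trans (≡.sym px) (q⊆p x (here ≡.refl) qx)))
... | false | true  = ℕₚ.m≤n⇒m≤1+n (length-filterᵇ-≤ p q xs (λ y → q⊆p y ∘ there))
... | false | false = length-filterᵇ-≤ p q xs (λ y → q⊆p y ∘ there)

length-filterᵇ-< : ∀ (p q : A → Bool) xs → (∀ x → x ∈ xs → q x ≡ true → p x ≡ true) →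
  ∀ {y} → y ∈ xs → p y ≡ true → q y ≡ false → length (filterᵇ q xs) < length (filterᵇ p xs)
length-filterᵇ-< p q (x ∷ xs) q⊆p (here ≡.refl) py qy rewrite py | qy =
  s≤s (length-filterᵇ-≤ p q xs (λ y → q⊆p y ∘ there))
length-filterᵇ-< p q (x ∷ xs) q⊆p (there y∈xs) py qy
  with length-filterᵇ-< p q xs (λ y → q⊆p y ∘ there) y∈xs py qy | q x in qx | p x in px
... | lt | true  | true  = s≤s lt
... | lt | true  | false = ⊥-elim (false≢true (≡.trans (≡.sym px) (q⊆p x (here ≡.refl) qx)))
... | lt | false | true  = ℕₚ.m<n⇒m<1+n lt
... | lt | false | false = lt

equal-count-⊆⇒⊇ : ∀ (p q : A → Bool) xs → length (filterᵇ q xs) ≡ length (filterᵇ p xs) →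
  (∀ x → x ∈ xs → q x ≡ true → p x ≡ true) → ∀ x → x ∈ xs → p x ≡ true → q x ≡ true
equal-count-⊆⇒⊇ p q xs same q⊆p x x∈xs px with q x in qx
... | true  = ≡.refl
... | false = ⊥-elim (ℕₚ.<-irrefl same (length-filterᵇ-< p q xs q⊆p x∈xs px qx))

concatMap-cong-local : ∀ {f g : A → List B} xs → (∀ x → x ∈ xs → f x ≡ g x) → concatMap f xs ≡ concatMap g xs
concatMap-cong-local []       _   = ≡.refl
concatMap-cong-local (x ∷ xs) f≗g = ≡.cong₂ _++_ (f≗g x (here ≡.refl)) (concatMap-cong-local xs (λ y → f≗g y ∘ there))

concatMap-[] : ∀ (f : A → List B) xs → (∀ x → x ∈ xs → f x ≡ []) → concatMap f xs ≡ []
concatMap-[] f []       _   = ≡.refl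
concatMap-[] f (x ∷ xs) f≡[] rewrite f≡[] x (here ≡.refl) = concatMap-[] f xs (λ y → f≡[] y ∘ there)

concatMap-↭ : ∀ (f : A → List B) {xs ys} → xs ↭ ys → concatMap f xs ↭ concatMap f ys
concatMap-↭ f ↭.refl          = ↭.refl
concatMap-↭ f (↭.prep x p)    = ↭ₚ.++⁺ˡ (f x) (concatMap-↭ f p)
concatMap-↭ f (↭.swap x y p)  = ↭.trans (↭ₚ.++⁺ˡ (f x) (↭ₚ.++⁺ˡ (f y) (concatMap-↭ f p))) (↭ₚ.shifts (f x) (f y))
concatMap-↭ f (↭.trans p q)   = ↭.trans (concatMap-↭ f p) (concatMap-↭ f q)

concatMap-↭-pointwise : ∀ {f g : A → List B} xs → (∀ x → x ∈ xs → f x ↭ g x) → concatMap f xs ↭ concatMap g xs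
concatMap-↭-pointwise []       _   = ↭.refl
concatMap-↭-pointwise (x ∷ xs) f↭g = ↭ₚ.++⁺ (f↭g x (here ≡.refl)) (concatMap-↭-pointwise xs (λ y → f↭g y ∘ there))

filterᵇ-≡ᵇ-interval : ∀ {a k c} → a ≤ k → k ≤ c → 1 ≤ k → filterᵇ (_≡ᵇ k) (interval a c) ≡ [ k ]
filterᵇ-≡ᵇ-interval {a} {k} {c} a≤k k≤c 1≤k
  rewrite interval-split a≤k k≤c 1≤k | filterᵇ-++ (_≡ᵇ k) (interval a (ℕ.pred k)) (k ∷ interval (suc k) c) | ≡ᵇ-refl k
        | filterᵇ-none (interval a (ℕ.pred k)) (λ x m → ≢⇒≡ᵇ-false (ℕₚ.<⇒≢ (∈-interval-pred⇒< 1≤k m)))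
        | filterᵇ-none (interval (suc k) c) (λ x m → ≢⇒≡ᵇ-false (ℕₚ.>⇒≢ (proj₁ (∈-interval⁻ m)))) = ≡.refl

transpose : ℕ → ℕ → ℕ
transpose b i = if i ≡ᵇ b then suc b else (if i ≡ᵇ suc b then b else i)

transpose-b : ∀ b → transpose b b ≡ suc b
transpose-b b rewrite ≡ᵇ-refl b = ≡.refl

transpose-1+b : ∀ b → transpose b (suc b) ≡ b
transpose-1+b b rewrite ≢⇒≡ᵇ-false (ℕₚ.1+n≢n {b}) | ≡ᵇ-refl b = ≡.refl

transpose-other : ∀ b {i} → i ≢ b → i ≢ suc b → transpose b i ≡ i
transpose-other b i≢b i≢1+b rewrite ≢⇒≡ᵇ-false i≢b | ≢⇒≡ᵇ-false i≢1+b = ≡.refl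

transpose-involutive : ∀ b i → transpose b (transpose b i) ≡ i
transpose-involutive b i with i ℕ.≟ b
... | yes ≡.refl rewrite transpose-b i = transpose-1+b i
... | no i≢b with i ℕ.≟ suc b
...   | yes ≡.refl rewrite transpose-1+b b = transpose-b b
...   | no i≢1+b rewrite transpose-other b i≢b i≢1+b = transpose-other b i≢b i≢1+b

transpose-≡ᵇ : ∀ b i j → (transpose b i ≡ᵇ j) ≡ (i ≡ᵇ transpose b j)
transpose-≡ᵇ b i j with i ℕ.≟ transpose b j
... | yes ≡.refl rewrite transpose-involutive b j | ≡ᵇ-refl j | ≡ᵇ-refl (transpose b j) = ≡.refl
... | no i≢ rewrite ≢⇒≡ᵇ-false i≢ =
  ≢⇒≡ᵇ-false {transpose b i} {j} (λ e → i≢ (≡.trans (≡.sym (transpose-involutive b i)) (≡.cong (transpose b) e)))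

transpose-respects : ∀ (f : ℕ → A) b → f b ≡ f (suc b) → ∀ i → f (transpose b i) ≡ f i
transpose-respects f b f[b]≡f[b+1] i with i ℕ.≟ b
... | yes ≡.refl rewrite transpose-b i = ≡.sym f[b]≡f[b+1]
... | no i≢b with i ℕ.≟ suc b
...   | yes ≡.refl rewrite transpose-1+b b = f[b]≡f[b+1]
...   | no i≢b+1 = ≡.cong f (transpose-other b i≢b i≢b+1)

transpose-invariant : ∀ (Φ : RootSet) b → (∀ j → Φ b j ≡ Φ (suc b) j) → (∀ i → Φ i b ≡ Φ i (suc b)) →
  ∀ i j → Φ (transpose b i) (transpose b j) ≡ Φ i j
transpose-invariant Φ b rows cols i j =
  ≡.trans (transpose-respects (λ k → Φ k (transpose b j)) b (rows (transpose b j)) i) (transpose-respects (Φ i) b (cols i) j)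

map-transpose-fixed : ∀ b xs → All (λ x → x ≢ b × x ≢ suc b) xs → map (transpose b) xs ≡ xs
map-transpose-fixed b []       []                   = ≡.refl
map-transpose-fixed b (x ∷ xs) ((x≢b , x≢1+b) ∷ ok) = ≡.cong₂ _∷_ (transpose-other b x≢b x≢1+b) (map-transpose-fixed b xs ok)

map-transpose-interval : ∀ ℓ b → 1 ≤ b → suc b ≤ ℓ → map (transpose b) (interval 1 ℓ) ↭ interval 1 ℓ
map-transpose-interval ℓ b 1≤b b<ℓ
  rewrite interval-split 1≤b (ℕₚ.<⇒≤ b<ℓ) 1≤b | interval-∷ b<ℓ
        | Listₚ.map-++ (transpose b) (interval 1 (ℕ.pred b)) (b ∷ suc b ∷ interval (suc (suc b)) ℓ)
        | map-transpose-fixed b (interval 1 (ℕ.pred b)) (All.tabulate λ m →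
            let x<b = ∈-interval-pred⇒< 1≤b m in ℕₚ.<⇒≢ x<b , ℕₚ.<⇒≢ (ℕₚ.m<n⇒m<1+n x<b))
        | map-transpose-fixed b (interval (suc (suc b)) ℓ) (All.tabulate λ m →
            let b<x = proj₁ (∈-interval⁻ {suc (suc b)} {ℓ} m) in ℕₚ.>⇒≢ (ℕₚ.<-trans (ℕₚ.n<1+n b) b<x) , ℕₚ.>⇒≢ b<x)
        | transpose-b b | transpose-1+b b =
  ↭ₚ.++⁺ˡ (interval 1 (ℕ.pred b)) (↭.swap (suc b) b ↭.refl)

-- The column reindexing of the minors in Sym.det.
skip : ℕ → ℕ → ℕ
skip j cc = if cc <ᵇ j then cc else suc cc

skip-< : ∀ {j cc} → cc < j → skip j cc ≡ cc
skip-< cc<j rewrite <⇒<ᵇ-true cc<j = ≡.refl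

skip-≥ : ∀ {j cc} → j ≤ cc → skip j cc ≡ suc cc
skip-≥ j≤cc rewrite ≥⇒<ᵇ-false j≤cc = ≡.refl

skip-skip : ∀ j k cc → j ≤ k → skip j (skip k cc) ≡ skip (suc k) (skip j cc)
skip-skip j k cc j≤k with cc ℕ.<? j
... | yes cc<j rewrite skip-< (ℕₚ.<-≤-trans cc<j j≤k) | skip-< cc<j | skip-< {suc k} (ℕₚ.m<n⇒m<1+n (ℕₚ.<-≤-trans cc<j j≤k)) = ≡.refl
... | no cc≮j with cc ℕ.<? k
...   | yes cc<k rewrite skip-< cc<k | skip-≥ (ℕₚ.≮⇒≥ cc≮j) | skip-< {suc k} (s≤s cc<k) = ≡.refl
...   | no cc≮k rewrite skip-≥ (ℕₚ.≮⇒≥ cc≮k) | skip-≥ (ℕₚ.≮⇒≥ cc≮j) | skip-≥ {j} (ℕₚ.m≤n⇒m≤1+n (ℕₚ.≮⇒≥ cc≮j))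
                       | skip-≥ {suc k} (s≤s (ℕₚ.≮⇒≥ cc≮k)) = ≡.refl

isRoot : RootSet → ℕ × ℕ → Bool
isRoot Ψ p = Ψ (proj₁ p) (proj₂ p)

isPair : ℕ → ℕ → ℕ × ℕ → Bool
isPair a b (i , j) = (i ≡ᵇ a) ∧ (j ≡ᵇ b)

positiveRoots : ℕ → List (ℕ × ℕ)
positiveRoots ℓ = concatMap (λ i → map (λ j → (i , j)) (interval (suc i) ℓ)) (interval 1 ℓ)

squareCells : ℕ → List (ℕ × ℕ)
squareCells ℓ = concatMap (λ i → map (λ j → (i , j)) (interval 1 ℓ)) (interval 1 ℓ)

-- Sym.rootsOf ℓ Ψ unfolds to roots ℓ Ψ.
roots : ℕ → RootSet → List (ℕ × ℕ)
roots ℓ Ψ = filterᵇ (isRoot Ψ) (positiveRoots ℓ)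

roots-cong : ∀ ℓ {Ψ Ψ' : RootSet} → (∀ i j → Ψ i j ≡ Ψ' i j) → roots ℓ Ψ ≡ roots ℓ Ψ'
roots-cong ℓ Ψ≗Ψ' = filterᵇ-cong-local (positiveRoots ℓ) (λ (i , j) _ → Ψ≗Ψ' i j)

∈-roots⁻ : ∀ ℓ Ψ {i j} → (i , j) ∈ roots ℓ Ψ → Ψ i j ≡ true
∈-roots⁻ ℓ Ψ = ∈-filterᵇ⁻ (positiveRoots ℓ)

filterᵇ-isPair-positiveRoots : ∀ ℓ a b → 1 ≤ a → a < b → b ≤ ℓ → filterᵇ (isPair a b) (positiveRoots ℓ) ≡ [ (a , b) ]
filterᵇ-isPair-positiveRoots ℓ a b 1≤a a<b b≤ℓ = begin
  filterᵇ (isPair a b) (concatMap row (interval 1 ℓ))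
    ≡⟨ filterᵇ-concatMap (isPair a b) row (interval 1 ℓ) ⟩
  concatMap (filterᵇ (isPair a b) ∘ row) (interval 1 ℓ)
    ≡⟨ ≡.cong (concatMap (filterᵇ (isPair a b) ∘ row)) (interval-split 1≤a a≤ℓ 1≤a) ⟩
  concatMap (filterᵇ (isPair a b) ∘ row) (interval 1 (ℕ.pred a) ++ a ∷ interval (suc a) ℓ)
    ≡⟨ Listₚ.concatMap-++ (filterᵇ (isPair a b) ∘ row) (interval 1 (ℕ.pred a)) (a ∷ interval (suc a) ℓ) ⟩
  concatMap (filterᵇ (isPair a b) ∘ row) (interval 1 (ℕ.pred a)) ++ filterᵇ (isPair a b) (row a) ++ concatMap (filterᵇ (isPair a b) ∘ row) (interval (suc a) ℓ)
    ≡⟨ ≡.cong₂ _++_ (concatMap-[] _ (interval 1 (ℕ.pred a)) (λ x x∈ → other-row x (ℕₚ.<⇒≢ (∈-interval-pred⇒< 1≤a x∈))))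
                    (≡.cong₂ _++_ row-a (concatMap-[] _ (interval (suc a) ℓ) (λ x x∈ → other-row x (ℕₚ.>⇒≢ (proj₁ (∈-interval⁻ {suc a} {ℓ} x∈)))))) ⟩
  [ (a , b) ] ∎
  where
  open ≡.≡-Reasoning
  row : ℕ → List (ℕ × ℕ)
  row i = map (λ j → (i , j)) (interval (suc i) ℓ)
  a≤ℓ : a ≤ ℓ
  a≤ℓ = ℕₚ.<⇒≤ (ℕₚ.<-≤-trans a<b b≤ℓ)
  other-row : ∀ x → x ≢ a → filterᵇ (isPair a b) (row x) ≡ []
  other-row x x≢a = filterᵇ-none (row x) λ p p∈ → case (∈-map⁻ (λ j → (x , j)) p∈)
    where case : ∀ {p} → ∃ (λ j → j ∈ interval (suc x) ℓ × p ≡ (x , j)) → isPair a b p ≡ false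
          case (j , _ , ≡.refl) rewrite ≢⇒≡ᵇ-false x≢a = ≡.refl
  row-a : filterᵇ (isPair a b) (row a) ≡ [ (a , b) ]
  row-a rewrite filterᵇ-map (isPair a b) (λ j → (a , j)) (interval (suc a) ℓ) | ≡ᵇ-refl a
              | filterᵇ-≡ᵇ-interval a<b b≤ℓ (ℕₚ.<-≤-trans (s≤s z≤n) a<b) = ≡.refl

roots-removeRoot-↭ : ∀ ℓ Ψ a b → Ψ a b ≡ true → 1 ≤ a → a < b → b ≤ ℓ →
  roots ℓ Ψ ↭ (a , b) ∷ roots ℓ (removeRoot a b Ψ)
roots-removeRoot-↭ ℓ Ψ a b ab∈Ψ 1≤a a<b b≤ℓ =
  ↭.trans (filterᵇ-partition-↭ (isRoot Ψ) (isPair a b) (positiveRoots ℓ))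
    (↭.↭-reflexive (≡.cong (_++ roots ℓ (removeRoot a b Ψ))
      (≡.trans (filterᵇ-cong-local (positiveRoots ℓ) (λ p _ → root-∧-pair p)) (filterᵇ-isPair-positiveRoots ℓ a b 1≤a a<b b≤ℓ))))
  where
  root-∧-pair : ∀ p → isRoot Ψ p ∧ isPair a b p ≡ isPair a b p
  root-∧-pair (i , j) with i ≡ᵇ a in i≡a | j ≡ᵇ b in j≡b
  ... | true  | true  = ≡.trans (∧-identityʳ _) (≡.subst₂ (λ u v → Ψ u v ≡ true) (≡.sym (≡ᵇ-true⇒≡ i≡a)) (≡.sym (≡ᵇ-true⇒≡ j≡b)) ab∈Ψ)
  ... | true  | false = ∧-zeroʳ _
  ... | false | _     = ∧-zeroʳ _

roots-squareCells : ∀ ℓ Ψ → (∀ i j → Ψ i j ≡ true → i < j) → roots ℓ Ψ ≡ filterᵇ (isRoot Ψ) (squareCells ℓ)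
roots-squareCells ℓ Ψ strict = ≡.trans (filterᵇ-concatMap (isRoot Ψ) _ (interval 1 ℓ))
  (≡.trans (concatMap-cong-local (interval 1 ℓ) full-row) (≡.sym (filterᵇ-concatMap (isRoot Ψ) _ (interval 1 ℓ))))
  where
  open ≡.≡-Reasoning
  row : ℕ → ℕ → ℕ → List (ℕ × ℕ)
  row i a c = map (λ j → (i , j)) (interval a c)
  below-diagonal : ∀ i → filterᵇ (isRoot Ψ) (row i 1 i) ≡ []
  below-diagonal i = filterᵇ-none (row i 1 i) λ p p∈ → case (∈-map⁻ (λ j → (i , j)) p∈)
    where case : ∀ {p} → ∃ (λ j → j ∈ interval 1 i × p ≡ (i , j)) → isRoot Ψ p ≡ false
          case (j , j∈ , ≡.refl) with Ψ i j in ij∈Ψ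
          ... | true  = ⊥-elim (ℕₚ.<⇒≱ (strict i j ij∈Ψ) (proj₂ (∈-interval⁻ {1} {i} j∈)))
          ... | false = ≡.refl
  full-row : ∀ i → i ∈ interval 1 ℓ → filterᵇ (isRoot Ψ) (row i (suc i) ℓ) ≡ filterᵇ (isRoot Ψ) (row i 1 ℓ)
  full-row i i∈ = ≡.sym (begin
    filterᵇ (isRoot Ψ) (row i 1 ℓ)
      ≡⟨ ≡.cong (filterᵇ (isRoot Ψ) ∘ map (λ j → (i , j))) (interval-++ (ℕₚ.m≤n⇒m≤1+n (proj₁ (∈-interval⁻ i∈))) (proj₂ (∈-interval⁻ i∈))) ⟩
    filterᵇ (isRoot Ψ) (map (λ j → (i , j)) (interval 1 i ++ interval (suc i) ℓ))
      ≡⟨ ≡.cong (filterᵇ (isRoot Ψ)) (Listₚ.map-++ _ (interval 1 i) (interval (suc i) ℓ)) ⟩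
    filterᵇ (isRoot Ψ) (row i 1 i ++ row i (suc i) ℓ)
      ≡⟨ filterᵇ-++ (isRoot Ψ) (row i 1 i) (row i (suc i) ℓ) ⟩
    filterᵇ (isRoot Ψ) (row i 1 i) ++ filterᵇ (isRoot Ψ) (row i (suc i) ℓ)
      ≡⟨ ≡.cong (_++ filterᵇ (isRoot Ψ) (row i (suc i) ℓ)) (below-diagonal i) ⟩
    filterᵇ (isRoot Ψ) (row i (suc i) ℓ) ∎)

transpose² : ℕ → ℕ × ℕ → ℕ × ℕ
transpose² b p = (transpose b (proj₁ p) , transpose b (proj₂ p))

map-transpose²-squareCells : ∀ ℓ b → 1 ≤ b → suc b ≤ ℓ → map (transpose² b) (squareCells ℓ) ↭ squareCells ℓ
map-transpose²-squareCells ℓ b 1≤b b<ℓ = begin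
  map (transpose² b) (concatMap row I)
    ≡⟨ Listₚ.map-concatMap (transpose² b) row I ⟩
  concatMap (λ i → map (transpose² b) (row i)) I
    ≡⟨ concatMap-cong-local I (λ i _ → ≡.trans (≡.sym (Listₚ.map-∘ I)) (Listₚ.map-∘ I)) ⟩
  concatMap (λ i → map (λ j → (transpose b i , j)) (map (transpose b) I)) I
    ↭⟨ concatMap-↭-pointwise I (λ i _ → ↭ₚ.map⁺ (λ j → (transpose b i , j)) transposed) ⟩
  concatMap (row ∘ transpose b) I
    ≡⟨ Listₚ.concatMap-map row (transpose b) I ⟨
  concatMap row (map (transpose b) I)
    ↭⟨ concatMap-↭ row transposed ⟩
  concatMap row I ∎
  where
  open ↭.PermutationReasoning
  I : List ℕ
  I = interval 1 ℓ
  row : ℕ → List (ℕ × ℕ)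
  row i = map (λ j → (i , j)) I
  transposed : map (transpose b) I ↭ I
  transposed = map-transpose-interval ℓ b 1≤b b<ℓ

-- positiveRoots is not stable under transpose² b, which sends (b, b + 1) to (b + 1, b); the full square is.
map-transpose²-roots-↭ : ∀ ℓ Ψ b → 1 ≤ b → suc b ≤ ℓ → (∀ i j → Ψ i j ≡ true → i < j) →
  (∀ i j → Ψ (transpose b i) (transpose b j) ≡ Ψ i j) → map (transpose² b) (roots ℓ Ψ) ↭ roots ℓ Ψ
map-transpose²-roots-↭ ℓ Ψ b 1≤b b<ℓ strict invariant rewrite roots-squareCells ℓ Ψ strict = begin
  map (transpose² b) (filterᵇ (isRoot Ψ) (squareCells ℓ))
    ≡⟨ ≡.cong (map (transpose² b)) (filterᵇ-cong-local (squareCells ℓ) (λ (i , j) _ → invariant i j)) ⟨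
  map (transpose² b) (filterᵇ (isRoot Ψ ∘ transpose² b) (squareCells ℓ))
    ≡⟨ filterᵇ-map (isRoot Ψ) (transpose² b) (squareCells ℓ) ⟨
  filterᵇ (isRoot Ψ) (map (transpose² b) (squareCells ℓ))
    ↭⟨ ↭ₚ.filter-↭ (T? ∘ isRoot Ψ) (map-transpose²-squareCells ℓ b 1≤b b<ℓ) ⟩
  filterᵇ (isRoot Ψ) (squareCells ℓ) ∎
  where open ↭.PermutationReasoning

Exponent : Set
Exponent = ℕ → ℤ

infix 4 _≼_ _≺_

_≼_ : ℤ → ℤ → Set
x ≼ y = ∃ λ k → x ℤ.+ + k ≡ y

_≺_ : ℤ → ℤ → Set
x ≺ y = x ℤ.+ 1ℤ ≼ y

≼-≺-trans : ∀ {x y z} → x ≼ y → y ≺ z → x ≺ z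
≼-≺-trans {x} (k , x+k≡y) (k' , y+1+k'≡z) =
  k ℕ.+ k' , ≡.trans (regroup x (+ k) (+ k')) (≡.trans (≡.cong (λ t → (t ℤ.+ 1ℤ) ℤ.+ + k') x+k≡y) y+1+k'≡z)
  where regroup : ∀ a b c → (a ℤ.+ 1ℤ) ℤ.+ (b ℤ.+ c) ≡ ((a ℤ.+ b) ℤ.+ 1ℤ) ℤ.+ c
        regroup = solve-∀

suffixSum : ℕ → ℕ → Exponent → ℤ
suffixSum b zero    β = 0ℤ
suffixSum b (suc n) β = β b ℤ.+ suffixSum (suc b) n β

indicator : ℕ → ℕ → ℕ → ℤ
indicator b zero    c = 0ℤ
indicator b (suc n) c = (if b ≡ᵇ c then 1ℤ else 0ℤ) ℤ.+ indicator (suc b) n c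

indicator-below : ∀ b n c → c < b → indicator b n c ≡ 0ℤ
indicator-below b zero    c c<b = ≡.refl
indicator-below b (suc n) c c<b rewrite ≢⇒≡ᵇ-false (ℕₚ.>⇒≢ c<b) =
  ≡.trans (ℤₚ.+-identityˡ _) (indicator-below (suc b) n c (ℕₚ.m<n⇒m<1+n c<b))

indicator-above : ∀ b n c → b + n ≤ c → indicator b n c ≡ 0ℤ
indicator-above b zero    c _       = ≡.refl
indicator-above b (suc n) c b+n≤c rewrite ≢⇒≡ᵇ-false (ℕₚ.<⇒≢ (ℕₚ.<-≤-trans (ℕₚ.m<m+n b (s≤s z≤n)) b+n≤c)) =
  ≡.trans (ℤₚ.+-identityˡ _) (indicator-above (suc b) n c (≡.subst (_≤ c) (ℕₚ.+-suc b n) b+n≤c))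

indicator-in : ∀ b n c → b ≤ c → c < b + n → indicator b n c ≡ 1ℤ
indicator-in b zero    c b≤c c<b+0 = ⊥-elim (ℕₚ.<⇒≱ c<b+0 (≡.subst (_≤ c) (≡.sym (ℕₚ.+-identityʳ b)) b≤c))
indicator-in b (suc n) c b≤c c<b+n with b ℕ.≟ c
... | yes ≡.refl rewrite ≡ᵇ-refl b | indicator-below (suc b) n b (ℕₚ.n<1+n b) = ≡.refl
... | no b≢c rewrite ≢⇒≡ᵇ-false b≢c =
  ≡.trans (ℤₚ.+-identityˡ _) (indicator-in (suc b) n c (ℕₚ.≤∧≢⇒< b≤c b≢c) (≡.subst (c <_) (ℕₚ.+-suc b n) c<b+n))

indicator-0∨1 : ∀ b n c → indicator b n c ≡ 0ℤ ⊎ indicator b n c ≡ 1ℤ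
indicator-0∨1 b n c with c ℕ.<? b
... | yes c<b = inj₁ (indicator-below b n c c<b)
... | no c≮b with c ℕ.<? b + n
...   | yes c<b+n = inj₂ (indicator-in b n c (ℕₚ.≮⇒≥ c≮b) c<b+n)
...   | no c≮b+n  = inj₁ (indicator-above b n c (ℕₚ.≮⇒≥ c≮b+n))

suffixSum-pigeonhole : ∀ b n β L → suffixSum b n β ≺ ℤ.- (+ (n ℕ.* L)) →
  ∃ λ j → b ≤ j × j < b + n × ∃ λ q → β j ℤ.+ + L ≡ -[1+ q ]
suffixSum-pigeonhole b zero    β L (k , ())
suffixSum-pigeonhole b (suc n) β L (k , sum≺) with β b ℤ.+ + L in β[b]+L
... | -[1+ q ] = b , ℕₚ.≤-refl , ℕₚ.m<m+n b (s≤s z≤n) , q , β[b]+L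
... | + p with suffixSum-pigeonhole (suc b) n β L (k ℕ.+ p , rest≺)
  where
  regroup : ∀ x S k p L → (S ℤ.+ 1ℤ) ℤ.+ (k ℤ.+ p) ≡ (((x ℤ.+ S) ℤ.+ 1ℤ) ℤ.+ k) ℤ.+ ((p ℤ.- (x ℤ.+ L)) ℤ.+ L)
  regroup = solve-∀
  cancel : ∀ L M → ℤ.- (L ℤ.+ M) ℤ.+ (0ℤ ℤ.+ L) ≡ ℤ.- M
  cancel = solve-∀
  rest≺ : (suffixSum (suc b) n β ℤ.+ 1ℤ) ℤ.+ + (k ℕ.+ p) ≡ ℤ.- (+ (n ℕ.* L))
  rest≺ = ≡.trans (regroup (β b) (suffixSum (suc b) n β) (+ k) (+ p) (+ L))
    (≡.trans (≡.cong₂ (λ u v → u ℤ.+ (v ℤ.+ + L)) sum≺ (≡.trans (≡.cong (λ t → t ℤ.- (β b ℤ.+ + L)) (≡.sym β[b]+L)) (ℤₚ.+-inverseʳ (β b ℤ.+ + L))))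
             (cancel (+ L) (+ (n ℕ.* L))))
...   | j , b<j , j<b+n , w = j , ℕₚ.<⇒≤ b<j , ≡.subst (j <_) (≡.sym (ℕₚ.+-suc b n)) j<b+n , w

eventually-≺ : ∀ (s c : ℤ) → ∃ λ N₀ → ∀ N → N₀ ≤ N → ∀ x → x ℤ.+ + suc N ≡ s → x ≺ c
eventually-≺ s c with s ℤ.- c in s-c
... | + d = d , λ N d≤N x x+N+1≡s → let (t , d+t≡N) = ℕₚ.m≤n⇒∃[o]m+o≡n d≤N in
  t , ≡.trans (regroup x (+ t) (+ d) c s)
        (≡.trans (≡.cong (λ u → (((x ℤ.+ + suc u) ℤ.- s) ℤ.+ (s ℤ.- c)) ℤ.- + d ℤ.+ c) d+t≡N)
        (≡.trans (≡.cong₂ (λ u v → ((u ℤ.- s) ℤ.+ v) ℤ.- + d ℤ.+ c) x+N+1≡s s-c) (cancel s (+ d) c)))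
  where
  regroup : ∀ x t d c s → (x ℤ.+ 1ℤ) ℤ.+ t ≡ (((x ℤ.+ (1ℤ ℤ.+ (d ℤ.+ t))) ℤ.- s) ℤ.+ (s ℤ.- c)) ℤ.- d ℤ.+ c
  regroup = solve-∀
  cancel : ∀ s d c → ((s ℤ.- s) ℤ.+ d) ℤ.- d ℤ.+ c ≡ c
  cancel = solve-∀
... | -[1+ d ] = 0 , λ N _ x x+N+1≡s → N ℕ.+ suc d ,
  ≡.trans (regroup x (+ N) (+ d) c s)
    (≡.trans (≡.cong₂ (λ u v → (((u ℤ.- s) ℤ.+ s) ℤ.- (s ℤ.- c)) ℤ.+ (v ℤ.+ (1ℤ ℤ.+ + d))) x+N+1≡s s-c) (cancel s c (+ d)))
  where
  regroup : ∀ x N d c s → (x ℤ.+ 1ℤ) ℤ.+ (N ℤ.+ (1ℤ ℤ.+ d)) ≡ (((x ℤ.+ (1ℤ ℤ.+ N)) ℤ.- s) ℤ.+ s ℤ.- (s ℤ.- c)) ℤ.+ ((s ℤ.- c) ℤ.+ (1ℤ ℤ.+ d))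
  regroup = solve-∀
  cancel : ∀ s c d → (((s ℤ.- s) ℤ.+ s) ℤ.- (s ℤ.- c)) ℤ.+ (ℤ.- (1ℤ ℤ.+ d) ℤ.+ (1ℤ ℤ.+ d)) ≡ c
  cancel = solve-∀

-[n]-1≡-[1+n] : ∀ n → ℤ.- (+ n) ℤ.+ -1ℤ ≡ ℤ.- (+ suc n)
-[n]-1≡-[1+n] zero    = ≡.refl
-[n]-1≡-[1+n] (suc n) = ≡.cong (λ k → -[1+ suc k ]) (ℕₚ.+-identityʳ n)

-- Truncated series in a commutative ring

module _ {c r : Level} (R : CommutativeRing c r) (h : ℕ → CommutativeRing.Carrier R) where

  open CommutativeRing R renaming (_+_ to _⊕_; _*_ to _⊛_; -_ to ⊝_; _-_ to _⊖_)
  open Sym R h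
  open import Algebra.Properties.Ring ring using (-0#≈0#; -‿involutive; -‿+-comm; -‿distribˡ-*; -‿distribʳ-*; x[y-z]≈xy-xz)
  open import Algebra.Properties.CommutativeSemigroup +-commutativeSemigroup using (interchange)
  open import Algebra.Properties.CommutativeSemigroup *-commutativeSemigroup using (x∙yz≈y∙xz)
  open import Relation.Binary.Reasoning.Setoid setoid

  ⊖-cong : ∀ {a b c d} → a ≈ b → c ≈ d → a ⊖ c ≈ b ⊖ d
  ⊖-cong a≈b c≈d = +-cong a≈b (-‿cong c≈d)

  x+y⊖y≈x : ∀ x y → x ⊕ y ⊖ y ≈ x
  x+y⊖y≈x x y = trans (+-assoc x y (⊝ y)) (trans (+-congˡ (-‿inverseʳ y)) (+-identityʳ x))

  x⊖0≈x : ∀ x → x ⊖ 0# ≈ x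
  x⊖0≈x x = trans (+-congˡ -0#≈0#) (+-identityʳ x)

  sumR-cong-< : ∀ n {f g : ℕ → Carrier} → (∀ i → i < n → f i ≈ g i) → sumR n f ≈ sumR n g
  sumR-cong-< zero    _   = refl
  sumR-cong-< (suc n) f≈g = +-cong (sumR-cong-< n (λ i i<n → f≈g i (ℕₚ.m<n⇒m<1+n i<n))) (f≈g n ℕₚ.≤-refl)

  sumR-cong : ∀ n {f g : ℕ → Carrier} → (∀ i → f i ≈ g i) → sumR n f ≈ sumR n g
  sumR-cong n f≈g = sumR-cong-< n (λ i _ → f≈g i)

  sumR-+ : ∀ n (f g : ℕ → Carrier) → sumR n (λ i → f i ⊕ g i) ≈ sumR n f ⊕ sumR n g
  sumR-+ zero    f g = sym (+-identityʳ 0#)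
  sumR-+ (suc n) f g = trans (+-congʳ (sumR-+ n f g)) (interchange (sumR n f) (sumR n g) (f n) (g n))

  sumR-⊝ : ∀ n (f : ℕ → Carrier) → sumR n (λ i → ⊝ f i) ≈ ⊝ sumR n f
  sumR-⊝ zero    f = sym -0#≈0#
  sumR-⊝ (suc n) f = trans (+-congʳ (sumR-⊝ n f)) (-‿+-comm (sumR n f) (f n))

  sumR-⊖ : ∀ n (f g : ℕ → Carrier) → sumR n (λ i → f i ⊖ g i) ≈ sumR n f ⊖ sumR n g
  sumR-⊖ n f g = trans (sumR-+ n f (λ i → ⊝ g i)) (+-congˡ (sumR-⊝ n g))

  sumR-*ˡ : ∀ n x (f : ℕ → Carrier) → sumR n (λ i → x ⊛ f i) ≈ x ⊛ sumR n f
  sumR-*ˡ zero    x f = sym (zeroʳ x)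
  sumR-*ˡ (suc n) x f = trans (+-congʳ (sumR-*ˡ n x f)) (sym (distribˡ x (sumR n f) (f n)))

  sumR-zero : ∀ n {f : ℕ → Carrier} → (∀ i → i < n → f i ≈ 0#) → sumR n f ≈ 0#
  sumR-zero zero    _   = refl
  sumR-zero (suc n) f≈0 =
    trans (+-cong (sumR-zero n (λ i i<n → f≈0 i (ℕₚ.m<n⇒m<1+n i<n))) (f≈0 n ℕₚ.≤-refl)) (+-identityʳ 0#)

  sumR-head : ∀ n (f : ℕ → Carrier) → sumR (suc n) f ≈ f 0 ⊕ sumR n (λ i → f (suc i))
  sumR-head zero    f = trans (+-identityˡ (f 0)) (sym (+-identityʳ (f 0)))
  sumR-head (suc n) f = trans (+-congʳ (sumR-head n f)) (+-assoc _ _ _)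

  sumR-comm : ∀ n m (f : ℕ → ℕ → Carrier) →
    sumR n (λ i → sumR m (λ j → f i j)) ≈ sumR m (λ j → sumR n (λ i → f i j))
  sumR-comm zero    m f = sym (sumR-zero m (λ _ _ → refl))
  sumR-comm (suc n) m f = trans (+-congʳ (sumR-comm n m f)) (sym (sumR-+ m _ _))

  shift-cong : ∀ {β β'} a d → β ≗ β' → shift β a d ≗ shift β' a d
  shift-cong {β} a d β≗β' i with i ≡ᵇ a
  ... | true  = ≡.cong (ℤ._+ d) (β≗β' i)
  ... | false = β≗β' i

  shift-≡ᵇ : ∀ β a d i → shift β a d i ≡ β i ℤ.+ (if i ≡ᵇ a then d else 0ℤ)
  shift-≡ᵇ β a d i with i ≡ᵇ a
  ... | true  = ≡.refl
  ... | false = ≡.sym (ℤₚ.+-identityʳ (β i))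

  shift-here : ∀ β a d → shift β a d a ≡ β a ℤ.+ d
  shift-here β a d rewrite ≡ᵇ-refl a = ≡.refl

  shift-other : ∀ β a d {i} → i ≢ a → shift β a d i ≡ β i
  shift-other β a d i≢a rewrite ≢⇒≡ᵇ-false i≢a = ≡.refl

  shift-comm : ∀ β a d b e → shift (shift β a d) b e ≗ shift (shift β b e) a d
  shift-comm β a d b e i with i ≡ᵇ a | i ≡ᵇ b
  ... | true  | true  = ℤ+ₚ.xy∙z≈xz∙y (β i) d e
  ... | true  | false = ≡.refl
  ... | false | true  = ≡.refl
  ... | false | false = ≡.refl

  shift-+ : ∀ β a d e → shift (shift β a d) a e ≗ shift β a (d ℤ.+ e)
  shift-+ β a d e i with i ≡ᵇ a
  ... | true  = ℤₚ.+-assoc (β i) d e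
  ... | false = ≡.refl

  shift-zero : ∀ β a → shift β a 0ℤ ≗ β
  shift-zero β a i with i ≡ᵇ a
  ... | true  = ℤₚ.+-identityʳ (β i)
  ... | false = ≡.refl

  Functional : Set c
  Functional = Exponent → Carrier

  Extensional : Functional → Set r
  Extensional F = ∀ {β β'} → β ≗ β' → F β ≈ F β'

  raiseBy : Exponent → ℕ × ℕ → ℕ → Exponent
  raiseBy γ (a , b) k = shift (shift γ a (+ k)) b (ℤ.- (+ k))

  raiseBy-cong : ∀ {β β'} α k → β ≗ β' → raiseBy β α k ≗ raiseBy β' α k
  raiseBy-cong (a , b) k β≗β' = shift-cong b _ (shift-cong a _ β≗β')

  raiseBy-comm : ∀ β α k α' k' → raiseBy (raiseBy β α k) α' k' ≗ raiseBy (raiseBy β α' k') α k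
  raiseBy-comm β (a , b) k (a' , b') k' =
    ≗-trans (shift-cong b' _ (shift-comm (shift β a (+ k)) b (ℤ.- (+ k)) a' (+ k')))
    (≗-trans (shift-comm (shift (shift β a (+ k)) a' (+ k')) b (ℤ.- (+ k)) b' (ℤ.- (+ k')))
    (≗-trans (shift-cong b _ (shift-cong b' _ (shift-comm β a (+ k) a' (+ k'))))
             (shift-cong b _ (shift-comm (shift β a' (+ k')) a (+ k) b' (ℤ.- (+ k'))))))

  shift-raiseBy : ∀ β α k d e → shift (raiseBy β α k) d e ≗ raiseBy (shift β d e) α k
  shift-raiseBy β (a , b) k d e =
    ≗-trans (shift-comm _ b _ d e) (shift-cong b _ (shift-comm β a _ d e))

  raise-ext : ∀ N rs {F} → Extensional F → Extensional (λ β → raise N rs β F)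
  raise-ext N []             F-ext β≗β' = F-ext β≗β'
  raise-ext N ((a , b) ∷ rs) F-ext β≗β' =
    sumR-cong (suc N) (λ k → raise-ext N rs F-ext (raiseBy-cong (a , b) k β≗β'))

  raise-cong : ∀ N rs {F G : Functional} → (∀ β → F β ≈ G β) → ∀ β → raise N rs β F ≈ raise N rs β G
  raise-cong N []             F≈G β = F≈G β
  raise-cong N ((a , b) ∷ rs) F≈G β = sumR-cong (suc N) (λ k → raise-cong N rs F≈G _)

  raise-⊖ : ∀ N rs (F G : Functional) β → raise N rs β (λ β → F β ⊖ G β) ≈ raise N rs β F ⊖ raise N rs β G
  raise-⊖ N []             F G β = refl
  raise-⊖ N ((a , b) ∷ rs) F G β = trans (sumR-cong (suc N) (λ k → raise-⊖ N rs F G _)) (sumR-⊖ (suc N) _ _)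

  raise-conj : ∀ N (T : Exponent → Exponent) (σ : ℕ × ℕ → ℕ × ℕ) →
    ∀ rs → (∀ α → α ∈ rs → ∀ β k → T (raiseBy β α k) ≗ raiseBy (T β) (σ α) k) →
    ∀ {F} → Extensional F → ∀ β → raise N rs β (F ∘ T) ≈ raise N (map σ rs) (T β) F
  raise-conj N T σ []             T-raiseBy F-ext β = refl
  raise-conj N T σ ((a , b) ∷ rs) T-raiseBy F-ext β with σ (a , b) in σab
  ... | (a' , b') = sumR-cong (suc N) λ k → trans
    (raise-conj N T σ rs (λ α → T-raiseBy α ∘ there) F-ext _)
    (raise-ext N (map σ rs) F-ext (≗-trans (T-raiseBy (a , b) (here ≡.refl) β k) (λ i → ≡.cong (λ α → raiseBy (T β) α k i) σab)))

  raise-↭ : ∀ N {rs rs'} → rs ↭ rs' → ∀ {F} → Extensional F → ∀ β → raise N rs β F ≈ raise N rs' β F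
  raise-↭ N ↭.refl                F-ext β = refl
  raise-↭ N (↭.prep (a , b) p)    F-ext β = sumR-cong (suc N) (λ k → raise-↭ N p F-ext _)
  raise-↭ N (↭.swap {ys = ys} α α' p) F-ext β with α | α'
  ... | (a , b) | (a' , b') = trans (sumR-comm (suc N) (suc N) _) (sumR-cong (suc N) λ k' → sumR-cong (suc N) λ k →
    trans (raise-↭ N p F-ext _) (raise-ext N ys F-ext (raiseBy-comm β (a , b) k (a' , b') k')))
  raise-↭ N (↭.trans p q)         F-ext β = trans (raise-↭ N p F-ext β) (raise-↭ N q F-ext β)

  altBinomialSum : ℕ → (ℕ → Carrier) → Carrier
  altBinomialSum n φ = sumR (suc n) (λ s → sgn s ⊛ (natR (n C s) ⊛ φ s))

  altBinomialSum-cong : ∀ n {φ ψ : ℕ → Carrier} → (∀ s → φ s ≈ ψ s) → altBinomialSum n φ ≈ altBinomialSum n ψ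
  altBinomialSum-cong n φ≈ψ = sumR-cong (suc n) (λ s → *-congˡ (*-congˡ (φ≈ψ s)))

  altBinomialSum-⊖ : ∀ n (φ ψ : ℕ → Carrier) →
    altBinomialSum n (λ s → φ s ⊖ ψ s) ≈ altBinomialSum n φ ⊖ altBinomialSum n ψ
  altBinomialSum-⊖ n φ ψ =
    trans (sumR-cong (suc n) (λ s → trans (*-congˡ (x[y-z]≈xy-xz _ _ _)) (x[y-z]≈xy-xz _ _ _))) (sumR-⊖ (suc n) _ _)

  altBinomialSum-comm : ∀ n n' (G : ℕ → ℕ → Carrier) →
    altBinomialSum n (λ s → altBinomialSum n' (G s)) ≈ altBinomialSum n' (λ s' → altBinomialSum n (λ s → G s s'))
  altBinomialSum-comm n n' G = begin
    sumR (suc n) (λ s → x s ⊛ (y s ⊛ sumR (suc n') (λ s' → x′ s' ⊛ (y′ s' ⊛ G s s'))))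
      ≈⟨ sumR-cong (suc n) (λ s → pull-in (suc n') (x s) (y s) _) ⟩
    sumR (suc n) (λ s → sumR (suc n') (λ s' → x s ⊛ (y s ⊛ (x′ s' ⊛ (y′ s' ⊛ G s s')))))
      ≈⟨ sumR-comm (suc n) (suc n') _ ⟩
    sumR (suc n') (λ s' → sumR (suc n) (λ s → x s ⊛ (y s ⊛ (x′ s' ⊛ (y′ s' ⊛ G s s')))))
      ≈⟨ sumR-cong (suc n') (λ s' → sumR-cong (suc n) (λ s → exchange (x s) (y s) (x′ s') (y′ s') (G s s'))) ⟩
    sumR (suc n') (λ s' → sumR (suc n) (λ s → x′ s' ⊛ (y′ s' ⊛ (x s ⊛ (y s ⊛ G s s')))))
      ≈⟨ sumR-cong (suc n') (λ s' → sym (pull-in (suc n) (x′ s') (y′ s') _)) ⟩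
    sumR (suc n') (λ s' → x′ s' ⊛ (y′ s' ⊛ sumR (suc n) (λ s → x s ⊛ (y s ⊛ G s s')))) ∎
    where
    x y x′ y′ : ℕ → Carrier
    x = sgn
    y s = natR (n C s)
    x′ = sgn
    y′ s' = natR (n' C s')
    pull-in : ∀ k a b (f : ℕ → Carrier) → a ⊛ (b ⊛ sumR k f) ≈ sumR k (λ i → a ⊛ (b ⊛ f i))
    pull-in k a b f = sym (trans (sumR-*ˡ k a _) (*-congˡ (sumR-*ˡ k b f)))
    exchange : ∀ a b c d e → a ⊛ (b ⊛ (c ⊛ (d ⊛ e))) ≈ c ⊛ (d ⊛ (a ⊛ (b ⊛ e)))
    exchange a b c d e = trans (*-congˡ (x∙yz≈y∙xz b c _)) (trans (x∙yz≈y∙xz a c _)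
      (*-congˡ (trans (*-congˡ (x∙yz≈y∙xz b d e)) (x∙yz≈y∙xz a d _))))

  natR-+ : ∀ a b → natR (a + b) ≈ natR a ⊕ natR b
  natR-+ zero    b = sym (+-identityˡ (natR b))
  natR-+ (suc a) b = trans (+-congˡ (natR-+ a b)) (sym (+-assoc 1# (natR a) (natR b)))

  natR-pascal : ∀ n s → natR (suc n C suc s) ≈ natR (n C s) ⊕ natR (n C suc s)
  natR-pascal n s = trans (reflexive (≡.cong natR (≡.sym (nCk+nC[k+1]≡[n+1]C[k+1] n s)))) (natR-+ (n C s) (n C suc s))

  altBinomialSum-pascal : ∀ n (φ : ℕ → Carrier) →
    altBinomialSum (suc n) φ ≈ altBinomialSum n (λ s → φ s ⊖ φ (suc s))
  altBinomialSum-pascal n φ = begin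
    sumR (suc (suc n)) (λ s → sgn s ⊛ (natR (suc n C s) ⊛ φ s))
      ≈⟨ sumR-head (suc n) _ ⟩
    t 0 ⊕ sumR (suc n) (λ s → sgn (suc s) ⊛ (natR (suc n C suc s) ⊛ φ (suc s)))
      ≈⟨ +-congˡ (trans (sumR-cong (suc n) split) (sumR-⊖ (suc n) _ _)) ⟩
    t 0 ⊕ (sumR n (λ s → t (suc s)) ⊕ t (suc n) ⊖ sumR (suc n) u)
      ≈⟨ +-congˡ (+-congʳ (trans (+-congˡ t[n+1]≈0) (+-identityʳ _))) ⟩
    t 0 ⊕ (sumR n (λ s → t (suc s)) ⊖ sumR (suc n) u)
      ≈⟨ sym (+-assoc _ _ _) ⟩
    (t 0 ⊕ sumR n (λ s → t (suc s))) ⊖ sumR (suc n) u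
      ≈⟨ +-congʳ (sym (sumR-head n t)) ⟩
    sumR (suc n) t ⊖ sumR (suc n) u
      ≈⟨ sym (altBinomialSum-⊖ n φ (φ ∘ suc)) ⟩
    altBinomialSum n (λ s → φ s ⊖ φ (suc s)) ∎
    where
    t u : ℕ → Carrier
    t s = sgn s ⊛ (natR (n C s) ⊛ φ s)
    u s = sgn s ⊛ (natR (n C s) ⊛ φ (suc s))
    t[n+1]≈0 : t (suc n) ≈ 0#
    t[n+1]≈0 rewrite k>n⇒nCk≡0 (ℕₚ.n<1+n n) = trans (*-congˡ (zeroˡ _)) (zeroʳ _)
    split : ∀ s → sgn (suc s) ⊛ (natR (suc n C suc s) ⊛ φ (suc s)) ≈ t (suc s) ⊖ u s
    split s = begin
      ⊝ sgn s ⊛ (natR (suc n C suc s) ⊛ φ (suc s))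
        ≈⟨ *-congˡ (trans (*-congʳ (natR-pascal n s)) (distribʳ _ _ _)) ⟩
      ⊝ sgn s ⊛ (natR (n C s) ⊛ φ (suc s) ⊕ natR (n C suc s) ⊛ φ (suc s))
        ≈⟨ distribˡ _ _ _ ⟩
      ⊝ sgn s ⊛ (natR (n C s) ⊛ φ (suc s)) ⊕ t (suc s)
        ≈⟨ trans (+-congʳ (sym (-‿distribˡ-* _ _))) (+-comm _ _) ⟩
      t (suc s) ⊖ u s ∎

  lowering : List ℕ → (ℕ → ℕ) → Functional → Functional
  lowering []       m F γ = F γ
  lowering (b ∷ bs) m F γ = altBinomialSum (m b) (λ s → lowering bs m F (shift γ b (ℤ.- (+ s))))

  lower-lowering : ∀ ℓ bs m γ → lower ℓ bs m γ ≈ lowering bs m (g ℓ) γ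
  lower-lowering ℓ []       m γ = refl
  lower-lowering ℓ (b ∷ bs) m γ = altBinomialSum-cong (m b) (λ s → lower-lowering ℓ bs m _)

  Ktrunc≈raise-lowering : ∀ ℓ N Ψ m γ → Ktrunc ℓ N Ψ m γ ≈ raise N (rootsOf ℓ Ψ) γ (lowering (interval 1 ℓ) m (g ℓ))
  Ktrunc≈raise-lowering ℓ N Ψ m γ = raise-cong N (rootsOf ℓ Ψ) (lower-lowering ℓ (interval 1 ℓ) m) γ

  lowering-ext : ∀ bs m {F} → Extensional F → Extensional (lowering bs m F)
  lowering-ext []       m F-ext β≗β' = F-ext β≗β'
  lowering-ext (b ∷ bs) m F-ext β≗β' = altBinomialSum-cong (m b) (λ s → lowering-ext bs m F-ext (shift-cong b _ β≗β'))

  lowering-cong : ∀ bs m {F G : Functional} → (∀ β → F β ≈ G β) → ∀ β → lowering bs m F β ≈ lowering bs m G β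
  lowering-cong []       m F≈G β = F≈G β
  lowering-cong (b ∷ bs) m F≈G β = altBinomialSum-cong (m b) (λ s → lowering-cong bs m F≈G _)

  lowering-cong-mult : ∀ bs m m' {F} → (∀ b → b ∈ bs → m b ≡ m' b) → ∀ β → lowering bs m F β ≈ lowering bs m' F β
  lowering-cong-mult []       m m' m≡m' β = refl
  lowering-cong-mult (b ∷ bs) m m' m≡m' β rewrite m≡m' b (here ≡.refl) =
    altBinomialSum-cong (m' b) (λ s → lowering-cong-mult bs m m' (λ b' → m≡m' b' ∘ there) _)

  lowering-⊖ : ∀ bs m (F G : Functional) β →
    lowering bs m (λ β → F β ⊖ G β) β ≈ lowering bs m F β ⊖ lowering bs m G β
  lowering-⊖ []       m F G β = refl
  lowering-⊖ (b ∷ bs) m F G β =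
    trans (altBinomialSum-cong (m b) (λ s → lowering-⊖ bs m F G _)) (altBinomialSum-⊖ (m b) _ _)

  lowering-conj : ∀ (T : Exponent → Exponent) (σ : ℕ → ℕ) bs m m' →
    (∀ b → b ∈ bs → ∀ β s → T (shift β b (ℤ.- (+ s))) ≗ shift (T β) (σ b) (ℤ.- (+ s))) →
    (∀ b → b ∈ bs → m' (σ b) ≡ m b) →
    ∀ {F} → Extensional F → ∀ β → lowering bs m (F ∘ T) β ≈ lowering (map σ bs) m' F (T β)
  lowering-conj T σ []       m m' T-shift m'σ F-ext β = refl
  lowering-conj T σ (b ∷ bs) m m' T-shift m'σ F-ext β rewrite m'σ b (here ≡.refl) =
    altBinomialSum-cong (m b) λ s → trans
      (lowering-conj T σ bs m m' (λ b' → T-shift b' ∘ there) (λ b' → m'σ b' ∘ there) F-ext _)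
      (lowering-ext (map σ bs) m' F-ext (T-shift b (here ≡.refl) β s))

  lowering-↭ : ∀ {bs bs'} → bs ↭ bs' → ∀ m {F} → Extensional F → ∀ β → lowering bs m F β ≈ lowering bs' m F β
  lowering-↭ ↭.refl         m F-ext β = refl
  lowering-↭ (↭.prep b p)   m F-ext β = altBinomialSum-cong (m b) (λ s → lowering-↭ p m F-ext _)
  lowering-↭ (↭.swap {xs} {ys} b b' p) m {F} F-ext β =
    trans (altBinomialSum-comm (m b) (m b') (λ s s' → lowering xs m F (shift (shift β b (ℤ.- (+ s))) b' (ℤ.- (+ s')))))
      (altBinomialSum-cong (m b') λ s' → altBinomialSum-cong (m b) λ s →
        trans (lowering-↭ p m F-ext _) (lowering-ext ys m F-ext (shift-comm β b (ℤ.- (+ s)) b' (ℤ.- (+ s')))))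
  lowering-↭ (↭.trans p q)  m F-ext β = trans (lowering-↭ p m F-ext β) (lowering-↭ q m F-ext β)

  lower₁ : ℕ → Functional → Functional
  lower₁ b F β = F β ⊖ F (shift β b -1ℤ)

  lower₁-ext : ∀ b {F} → Extensional F → Extensional (lower₁ b F)
  lower₁-ext b F-ext β≗β' = ⊖-cong (F-ext β≗β') (F-ext (shift-cong b -1ℤ β≗β'))

  lowering-lower₁ : ∀ bs m b {F} → Extensional F → ∀ β → lowering bs m (lower₁ b F) β ≈ lower₁ b (lowering bs m F) β
  lowering-lower₁ bs m b {F} F-ext β = trans (lowering-⊖ bs m F _ β) (+-congˡ (-‿cong (trans
    (lowering-conj (λ β' → shift β' b -1ℤ) id bs m m (λ b' _ β' s → shift-comm β' b' _ b -1ℤ) (λ _ _ → ≡.refl) F-ext β)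
    (reflexive (≡.cong (λ bs' → lowering bs' m F (shift β b -1ℤ)) (Listₚ.map-id bs))))))

  raise-lower₁ : ∀ N rs b {F} → Extensional F → ∀ β → raise N rs β (lower₁ b F) ≈ lower₁ b (λ β' → raise N rs β' F) β
  raise-lower₁ N rs b {F} F-ext β = trans (raise-⊖ N rs F _ β) (+-congˡ (-‿cong (trans
    (raise-conj N (λ β' → shift β' b -1ℤ) id rs (λ α _ β' k → shift-raiseBy β' α k b -1ℤ) F-ext β)
    (reflexive (≡.cong (λ rs' → raise N rs' (shift β b -1ℤ) F) (Listₚ.map-id rs))))))

  lowering-peel : ∀ pre post b m m' {F} → Extensional F → (∀ j → j ∈ pre ++ post → m j ≡ m' j) → m b ≡ suc (m' b) →
    ∀ β → lowering (pre ++ b ∷ post) m F β ≈ lowering (pre ++ b ∷ post) m' (lower₁ b F) β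
  lowering-peel [] post b m m' {F} F-ext m≡m' m[b] β rewrite m[b] = begin
    altBinomialSum (suc (m' b)) φ                  ≈⟨ altBinomialSum-pascal (m' b) φ ⟩
    altBinomialSum (m' b) (λ s → φ s ⊖ φ (suc s))  ≈⟨ altBinomialSum-cong (m' b) (λ s → sym (difference s)) ⟩
    altBinomialSum (m' b) (λ s → lowering post m' (lower₁ b F) (shift β b (ℤ.- (+ s)))) ∎
    where
    φ : ℕ → Carrier
    φ s = lowering post m F (shift β b (ℤ.- (+ s)))
    difference : ∀ s → lowering post m' (lower₁ b F) (shift β b (ℤ.- (+ s))) ≈ φ s ⊖ φ (suc s)
    difference s = begin
      lowering post m' (lower₁ b F) (shift β b (ℤ.- (+ s)))
        ≈⟨ lowering-lower₁ post m' b F-ext _ ⟩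
      lowering post m' F (shift β b (ℤ.- (+ s))) ⊖ lowering post m' F (shift (shift β b (ℤ.- (+ s))) b -1ℤ)
        ≈⟨ ⊖-cong (sym (lowering-cong-mult post m m' m≡m' _)) (trans (sym (lowering-cong-mult post m m' m≡m' _))
             (lowering-ext post m F-ext (≗-trans (shift-+ β b _ -1ℤ) (λ i → ≡.cong (λ d → shift β b d i) (-[n]-1≡-[1+n] s))))) ⟩
      φ s ⊖ φ (suc s) ∎
  lowering-peel (c ∷ pre) post b m m' F-ext m≡m' m[b] β rewrite m≡m' c (here ≡.refl) =
    altBinomialSum-cong (m' c) (λ s → lowering-peel pre post b m m' F-ext (λ j → m≡m' j ∘ there) m[b] _)

  lowering-interval-peel : ∀ ℓ k m m' {F} → Extensional F → 1 ≤ k → k ≤ ℓ →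
    (∀ j → j ≢ k → m j ≡ m' j) → m k ≡ suc (m' k) →
    ∀ β → lowering (interval 1 ℓ) m F β ≈ lowering (interval 1 ℓ) m' (lower₁ k F) β
  lowering-interval-peel ℓ k m m' F-ext 1≤k k≤ℓ m≡m' m[k] β rewrite interval-split 1≤k k≤ℓ 1≤k =
    lowering-peel (interval 1 (ℕ.pred k)) (interval (suc k) ℓ) k m m' F-ext (λ j j∈ → m≡m' j (avoid j j∈)) m[k] β
    where
    avoid : ∀ j → j ∈ interval 1 (ℕ.pred k) ++ interval (suc k) ℓ → j ≢ k
    avoid j j∈ with ∈-++⁻ (interval 1 (ℕ.pred k)) j∈
    ... | inj₁ below = ℕₚ.<⇒≢ (∈-interval-pred⇒< 1≤k below)
    ... | inj₂ above = ℕₚ.>⇒≢ (proj₁ (∈-interval⁻ {suc k} {ℓ} above))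

  -- Determinants

  sumR-split : ∀ j n (f : ℕ → Carrier) → j ≤ n → sumR n f ≈ sumR j f ⊕ sumR (n ∸ j) (λ t → f (j + t))
  sumR-split zero    n       f _         = sym (+-identityˡ _)
  sumR-split (suc j) (suc n) f (s≤s j≤n) = begin
    sumR (suc n) f                                                        ≈⟨ sumR-head n f ⟩
    f 0 ⊕ sumR n (λ i → f (suc i))                                        ≈⟨ +-congˡ (sumR-split j n (λ i → f (suc i)) j≤n) ⟩
    f 0 ⊕ (sumR j (λ i → f (suc i)) ⊕ sumR (n ∸ j) (λ t → f (suc (j + t)))) ≈⟨ sym (+-assoc _ _ _) ⟩
    (f 0 ⊕ sumR j (λ i → f (suc i))) ⊕ sumR (n ∸ j) (λ t → f (suc (j + t))) ≈⟨ +-congʳ (sym (sumR-head j f)) ⟩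
    sumR (suc j) f ⊕ sumR (n ∸ j) (λ t → f (suc (j + t)))                 ∎

  sumR-triangle : ∀ n (f : ℕ → ℕ → Carrier) →
    sumR n (λ p → sumR (n ∸ suc p) (λ t → f p (suc p + t))) ≈ sumR n (λ q → sumR q (λ p → f p q))
  sumR-triangle zero    f = refl
  sumR-triangle (suc n) f = begin
    sumR n (λ p → sumR (suc n ∸ suc p) (λ t → f p (suc p + t))) ⊕ sumR (n ∸ n) (λ t → f n (suc n + t))
      ≈⟨ +-cong (sumR-cong-< n (λ p p<n → last-column p p<n)) (sumR-zero (n ∸ n) (λ t t< → ⊥-elim (ℕₚ.n≮0 (≡.subst (t <_) (ℕₚ.n∸n≡0 n) t<)))) ⟩
    sumR n (λ p → sumR (n ∸ suc p) (λ t → f p (suc p + t)) ⊕ f p n) ⊕ 0#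
      ≈⟨ trans (+-identityʳ _) (sumR-+ n _ _) ⟩
    sumR n (λ p → sumR (n ∸ suc p) (λ t → f p (suc p + t))) ⊕ sumR n (λ p → f p n)
      ≈⟨ +-congʳ (sumR-triangle n f) ⟩
    sumR n (λ q → sumR q (λ p → f p q)) ⊕ sumR n (λ p → f p n) ∎
    where
    last-column : ∀ p → p < n → sumR (n ∸ p) (λ t → f p (suc p + t)) ≈ sumR (n ∸ suc p) (λ t → f p (suc p + t)) ⊕ f p n
    last-column p p<n rewrite ℕₚ.+-∸-assoc 1 p<n = +-congˡ (reflexive (≡.cong (f p) (ℕₚ.m+[n∸m]≡n p<n)))

  Matrix : Set c
  Matrix = ℕ → ℕ → Carrier

  minor : Matrix → ℕ → Matrix
  minor A j rr cc = A (suc rr) (skip j cc)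

  swapRows : ℕ → Matrix → Matrix
  swapRows r A rr cc = if rr ≡ᵇ r then A (suc r) cc else (if rr ≡ᵇ suc r then A r cc else A rr cc)

  det-cong : ∀ n {A B : Matrix} → (∀ rr cc → A rr cc ≈ B rr cc) → det n A ≈ det n B
  det-cong zero    A≈B = refl
  det-cong (suc n) A≈B = sumR-cong (suc n) (λ j → *-congˡ (*-cong (A≈B 0 j) (det-cong n (λ rr cc → A≈B (suc rr) _))))

  det-zero-row : ∀ n (A : Matrix) rr → rr < n → (∀ cc → cc < n → A rr cc ≈ 0#) → det n A ≈ 0#
  det-zero-row (suc n) A zero     _          A≈0 =
    sumR-zero (suc n) (λ j j<n → trans (*-congˡ (trans (*-congʳ (A≈0 j j<n)) (zeroˡ _))) (zeroʳ _))
  det-zero-row (suc n) A (suc rr) (s≤s rr<n) A≈0 =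
    sumR-zero (suc n) (λ j j<n → trans (*-congˡ (trans (*-congˡ (det-zero-row n _ rr rr<n (λ cc cc<n → A≈0 _ (skip-bounded j cc j<n cc<n)))) (zeroʳ _))) (zeroʳ _))
    where
    skip-bounded : ∀ j cc → j < suc n → cc < n → skip j cc < suc n
    skip-bounded j cc j<n cc<n with cc <ᵇ j
    ... | true  = ℕₚ.m<n⇒m<1+n cc<n
    ... | false = s≤s cc<n

  det-linear : ∀ n r (A P Q : Matrix) → r < n →
    (∀ cc → A r cc ≈ P r cc ⊖ Q r cc) →
    (∀ rr → rr ≢ r → ∀ cc → A rr cc ≈ P rr cc × A rr cc ≈ Q rr cc) →
    det n A ≈ det n P ⊖ det n Q
  det-linear (suc n) zero A P Q _ A≈P-Q A≈P,Q = begin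
    sumR (suc n) (λ j → sgn j ⊛ (A 0 j ⊛ det n (minor A j)))
      ≈⟨ sumR-cong (suc n) (λ j → *-congˡ (trans (*-congʳ (A≈P-Q j)) (distrib-⊖ _ _ _))) ⟩
    sumR (suc n) (λ j → sgn j ⊛ (P 0 j ⊛ det n (minor A j) ⊖ Q 0 j ⊛ det n (minor A j)))
      ≈⟨ sumR-cong (suc n) (λ j → trans (x[y-z]≈xy-xz _ _ _) (⊖-cong
           (*-congˡ (*-congˡ (det-cong n (λ rr cc → proj₁ (A≈P,Q (suc rr) (λ ()) _)))))
           (*-congˡ (*-congˡ (det-cong n (λ rr cc → proj₂ (A≈P,Q (suc rr) (λ ()) _))))))) ⟩
    sumR (suc n) (λ j → sgn j ⊛ (P 0 j ⊛ det n (minor P j)) ⊖ sgn j ⊛ (Q 0 j ⊛ det n (minor Q j)))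
      ≈⟨ sumR-⊖ (suc n) _ _ ⟩
    det (suc n) P ⊖ det (suc n) Q ∎
    where open import Algebra.Properties.Ring ring using () renaming ([y-z]x≈yx-zx to distrib-⊖)
  det-linear (suc n) (suc r) A P Q (s≤s r<n) A≈P-Q A≈P,Q = begin
    sumR (suc n) (λ j → sgn j ⊛ (A 0 j ⊛ det n (minor A j)))
      ≈⟨ sumR-cong (suc n) (λ j → *-congˡ (*-cong (proj₁ (A≈P,Q 0 (λ ()) j))
           (det-linear n r (minor A j) (minor P j) (minor Q j) r<n (λ cc → A≈P-Q _) (λ rr rr≢r cc → A≈P,Q (suc rr) (rr≢r ∘ ℕₚ.suc-injective) _)))) ⟩
    sumR (suc n) (λ j → sgn j ⊛ (P 0 j ⊛ (det n (minor P j) ⊖ det n (minor Q j))))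
      ≈⟨ sumR-cong (suc n) (λ j → trans (*-congˡ (x[y-z]≈xy-xz _ _ _)) (trans (x[y-z]≈xy-xz _ _ _)
           (+-congˡ (-‿cong (*-congˡ (*-congʳ (trans (sym (proj₁ (A≈P,Q 0 (λ ()) j))) (proj₂ (A≈P,Q 0 (λ ()) j))))))))) ⟩
    sumR (suc n) (λ j → sgn j ⊛ (P 0 j ⊛ det n (minor P j)) ⊖ sgn j ⊛ (Q 0 j ⊛ det n (minor Q j)))
      ≈⟨ sumR-⊖ (suc n) _ _ ⟩
    det (suc n) P ⊖ det (suc n) Q ∎

  -- Laplace expansion along the first two rows, grouped by the pair of columns p < q they use:
  -- pairTerm₁ puts row 0 in column q, pairTerm₂ puts it in column p.
  twoRowMinor : ℕ → Matrix → ℕ → ℕ → Carrier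
  twoRowMinor n A p q = det n (λ rr cc → A (suc (suc rr)) (skip q (skip p cc)))

  pairTerm₁ pairTerm₂ : ℕ → Matrix → ℕ → ℕ → Carrier
  pairTerm₁ n A p q = sgn q ⊛ (A 0 q ⊛ (sgn p ⊛ (A 1 p ⊛ twoRowMinor n A p q)))
  pairTerm₂ n A p q = sgn p ⊛ (A 0 p ⊛ (⊝ sgn q ⊛ (A 1 q ⊛ twoRowMinor n A p q)))

  pairSum : ℕ → Matrix → (ℕ → Matrix → ℕ → ℕ → Carrier) → Carrier
  pairSum n A T = sumR (suc (suc n)) (λ q → sumR q (λ p → T n A p q))

  det-laplace₂ : ∀ n A → det (suc (suc n)) A ≈ pairSum n A pairTerm₁ ⊕ pairSum n A pairTerm₂
  det-laplace₂ n A = begin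
    det (suc (suc n)) A
      ≈⟨ sumR-cong (suc (suc n)) (λ j → sym (trans (sumR-*ˡ (suc n) (sgn j) _) (*-congˡ (sumR-*ˡ (suc n) (A 0 j) _)))) ⟩
    sumR (suc (suc n)) (λ j → sumR (suc n) (X j))
      ≈⟨ sumR-cong-< (suc (suc n)) (λ j j< → sumR-split j (suc n) (X j) (ℕₚ.≤-pred j<)) ⟩
    sumR (suc (suc n)) (λ j → sumR j (X j) ⊕ sumR (suc n ∸ j) (λ t → X j (j + t)))
      ≈⟨ sumR-+ (suc (suc n)) _ _ ⟩
    sumR (suc (suc n)) (λ j → sumR j (X j)) ⊕ sumR (suc (suc n)) (λ j → sumR (suc n ∸ j) (λ t → X j (j + t)))
      ≈⟨ +-cong (sumR-cong (suc (suc n)) (λ q → sumR-cong-< q (λ p p<q → column-before q p p<q)))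
                (trans (sumR-cong (suc (suc n)) (λ p → sumR-cong (suc n ∸ p) (λ t → column-after p t))) (sumR-triangle (suc (suc n)) (pairTerm₂ n A))) ⟩
    pairSum n A pairTerm₁ ⊕ pairSum n A pairTerm₂ ∎
    where
    X : ℕ → ℕ → Carrier
    X j k = sgn j ⊛ (A 0 j ⊛ (sgn k ⊛ (A 1 (skip j k) ⊛ det n (λ rr cc → A (suc (suc rr)) (skip j (skip k cc))))))
    column-before : ∀ q p → p < q → X q p ≈ pairTerm₁ n A p q
    column-before q p p<q rewrite skip-< p<q = refl
    column-after : ∀ p t → X p (p + t) ≈ pairTerm₂ n A p (suc p + t)
    column-after p t rewrite skip-≥ {p} {p + t} (ℕₚ.m≤m+n p t) =
      *-congˡ (*-congˡ (*-cong (sym (-‿involutive (sgn (p + t))))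
        (*-congˡ (det-cong n (λ rr cc → reflexive (≡.cong (A (suc (suc rr))) (skip-skip p (p + t) cc (ℕₚ.m≤m+n p t))))))))

  private
    exchange₄ : ∀ a b c d e → a ⊛ (b ⊛ (c ⊛ (d ⊛ e))) ≈ c ⊛ (d ⊛ (a ⊛ (b ⊛ e)))
    exchange₄ a b c d e = trans (*-congˡ (x∙yz≈y∙xz b c _)) (trans (x∙yz≈y∙xz a c _)
      (*-congˡ (trans (*-congˡ (x∙yz≈y∙xz b d e)) (x∙yz≈y∙xz a d _))))

    ⊝-inner : ∀ a b c d e → a ⊛ (b ⊛ (⊝ c ⊛ (d ⊛ e))) ≈ ⊝ (a ⊛ (b ⊛ (c ⊛ (d ⊛ e))))
    ⊝-inner a b c d e = trans (*-congˡ (*-congˡ (sym (-‿distribˡ-* c _)))) (trans (*-congˡ (sym (-‿distribʳ-* b _))) (sym (-‿distribʳ-* a _)))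

    pairSum-⊝ : ∀ n A T → pairSum n A (λ n A p q → ⊝ T n A p q) ≈ ⊝ pairSum n A T
    pairSum-⊝ n A T = trans (sumR-cong (suc (suc n)) (λ q → sumR-⊝ q _)) (sumR-⊝ (suc (suc n)) _)

  det-swapRows₀ : ∀ n A → det (suc (suc n)) (swapRows 0 A) ≈ ⊝ det (suc (suc n)) A
  det-swapRows₀ n A = begin
    det (suc (suc n)) (swapRows 0 A)
      ≈⟨ det-laplace₂ n (swapRows 0 A) ⟩
    pairSum n (swapRows 0 A) pairTerm₁ ⊕ pairSum n (swapRows 0 A) pairTerm₂
      ≈⟨ +-cong (sumR-cong (suc (suc n)) (λ q → sumR-cong q (λ p → term₁ p q))) (sumR-cong (suc (suc n)) (λ q → sumR-cong q (λ p → term₂ p q))) ⟩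
    pairSum n A (λ n A p q → ⊝ pairTerm₂ n A p q) ⊕ pairSum n A (λ n A p q → ⊝ pairTerm₁ n A p q)
      ≈⟨ +-cong (pairSum-⊝ n A pairTerm₂) (pairSum-⊝ n A pairTerm₁) ⟩
    ⊝ pairSum n A pairTerm₂ ⊕ ⊝ pairSum n A pairTerm₁
      ≈⟨ trans (+-comm _ _) (-‿+-comm _ _) ⟩
    ⊝ (pairSum n A pairTerm₁ ⊕ pairSum n A pairTerm₂)
      ≈⟨ -‿cong (sym (det-laplace₂ n A)) ⟩
    ⊝ det (suc (suc n)) A ∎
    where
    term₁ : ∀ p q → pairTerm₁ n (swapRows 0 A) p q ≈ ⊝ pairTerm₂ n A p q
    term₁ p q = sym (trans (-‿cong (⊝-inner _ _ _ _ _)) (trans (-‿involutive _) (exchange₄ _ _ _ _ _)))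
    term₂ : ∀ p q → pairTerm₂ n (swapRows 0 A) p q ≈ ⊝ pairTerm₁ n A p q
    term₂ p q = trans (⊝-inner _ _ _ _ _) (-‿cong (exchange₄ _ _ _ _ _))

  det-equalRows₀ : ∀ n A → (∀ cc → A 0 cc ≈ A 1 cc) → det (suc (suc n)) A ≈ 0#
  det-equalRows₀ n A A₀≈A₁ = begin
    det (suc (suc n)) A                                                          ≈⟨ det-laplace₂ n A ⟩
    pairSum n A pairTerm₁ ⊕ pairSum n A pairTerm₂                                ≈⟨ +-congˡ (sumR-cong (suc (suc n)) (λ q → sumR-cong q (λ p → term₂ p q))) ⟩
    pairSum n A pairTerm₁ ⊕ pairSum n A (λ n A p q → ⊝ pairTerm₁ n A p q)       ≈⟨ +-congˡ (pairSum-⊝ n A pairTerm₁) ⟩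
    pairSum n A pairTerm₁ ⊖ pairSum n A pairTerm₁                               ≈⟨ -‿inverseʳ _ ⟩
    0# ∎
    where
    term₂ : ∀ p q → pairTerm₂ n A p q ≈ ⊝ pairTerm₁ n A p q
    term₂ p q = trans (⊝-inner _ _ _ _ _) (-‿cong (trans (exchange₄ _ _ _ _ _) (*-congˡ (*-cong (sym (A₀≈A₁ q)) (*-congˡ (*-congʳ (A₀≈A₁ p)))))))

  det-swapRows : ∀ n r A → suc r < n → det n (swapRows r A) ≈ ⊝ det n A
  det-swapRows (suc (suc n)) zero    A _         = det-swapRows₀ n A
  det-swapRows (suc n)       (suc r) A (s≤s r<n) = begin
    sumR (suc n) (λ j → sgn j ⊛ (A 0 j ⊛ det n (swapRows r (minor A j))))
      ≈⟨ sumR-cong (suc n) (λ j → *-congˡ (*-congˡ (det-swapRows n r (minor A j) r<n))) ⟩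
    sumR (suc n) (λ j → sgn j ⊛ (A 0 j ⊛ ⊝ det n (minor A j)))
      ≈⟨ trans (sumR-cong (suc n) (λ j → trans (*-congˡ (sym (-‿distribʳ-* _ _))) (sym (-‿distribʳ-* _ _)))) (sumR-⊝ (suc n) _) ⟩
    ⊝ det (suc n) A ∎

  det-equalRows : ∀ n r A → suc r < n → (∀ cc → A r cc ≈ A (suc r) cc) → det n A ≈ 0#
  det-equalRows (suc (suc n)) zero    A _         Aᵣ≈Aᵣ₊₁ = det-equalRows₀ n A Aᵣ≈Aᵣ₊₁
  det-equalRows (suc n)       (suc r) A (s≤s r<n) Aᵣ≈Aᵣ₊₁ =
    sumR-zero (suc n) (λ j _ → trans (*-congˡ (*-congˡ (det-equalRows n r (minor A j) r<n (λ cc → Aᵣ≈Aᵣ₊₁ _)))) (trans (*-congˡ (zeroʳ _)) (zeroʳ _)))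

  -- Straightening

  kfun-cong : ∀ r {x y} → x ≡ y → kfun r x ≈ kfun r y
  kfun-cong r ≡.refl = refl

  kfun-pascal : ∀ r (n : ℤ) → kfun (suc r) n ≈ kfun (suc r) (n ℤ.+ -1ℤ) ⊕ kfun r n
  kfun-pascal r -[1+ k ]   = sym (+-identityʳ 0#)
  kfun-pascal r (+ zero)   = sym (+-identityˡ _)
  kfun-pascal r (+ suc k) = begin
    sumR (suc (suc k)) (λ i → natR ((r + i) C i) ⊛ h (suc k ∸ i))
      ≈⟨ sumR-head (suc k) _ ⟩
    t₀ ⊕ sumR (suc k) (λ i → natR ((r + suc i) C suc i) ⊛ h (k ∸ i))
      ≈⟨ +-congˡ (trans (sumR-cong (suc k) pascal) (sumR-+ (suc k) _ _)) ⟩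
    t₀ ⊕ (S ⊕ S′)
      ≈⟨ trans (sym (+-assoc _ _ _)) (trans (+-congʳ (+-comm _ _)) (+-assoc _ _ _)) ⟩
    S ⊕ (t₀ ⊕ S′)
      ≈⟨ +-congˡ (+-congˡ (sumR-cong (suc k) reindex)) ⟩
    S ⊕ (t₀ ⊕ sumR (suc k) (λ i → natR ((r + suc i ∸ 1) C suc i) ⊛ h (k ∸ i)))
      ≈⟨ +-congˡ (sym (sumR-head (suc k) _)) ⟩
    S ⊕ sumR (suc (suc k)) (λ i → natR ((r + i ∸ 1) C i) ⊛ h (suc k ∸ i)) ∎
    where
    t₀ S S′ : Carrier
    t₀ = natR ((r + 0) C 0) ⊛ h (suc k)
    S  = sumR (suc k) (λ i → natR ((r + i) C i) ⊛ h (k ∸ i))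
    S′ = sumR (suc k) (λ i → natR ((r + i) C suc i) ⊛ h (k ∸ i))
    pascal : ∀ i → natR ((r + suc i) C suc i) ⊛ h (k ∸ i) ≈ natR ((r + i) C i) ⊛ h (k ∸ i) ⊕ natR ((r + i) C suc i) ⊛ h (k ∸ i)
    pascal i rewrite ℕₚ.+-suc r i = trans (*-congʳ (natR-pascal (r + i) i)) (distribʳ _ _ _)
    reindex : ∀ i → natR ((r + i) C suc i) ⊛ h (k ∸ i) ≈ natR ((r + suc i ∸ 1) C suc i) ⊛ h (k ∸ i)
    reindex i rewrite ℕₚ.+-suc r i = refl

  kfun-difference : ∀ r (n : ℤ) → kfun r n ≈ kfun (suc r) n ⊖ kfun (suc r) (n ℤ.+ -1ℤ)
  kfun-difference r n = sym (trans (+-congʳ (trans (kfun-pascal r n) (+-comm _ _))) (x+y⊖y≈x _ _))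

  gMatrix : Exponent → Matrix
  gMatrix β rr cc = kfun rr ((β (suc rr) ℤ.+ + cc) ℤ.- + rr)

  g-ext : ∀ ℓ → Extensional (g ℓ)
  g-ext ℓ β≗β' = det-cong ℓ (λ rr cc → kfun-cong rr (≡.cong (λ t → (t ℤ.+ + cc) ℤ.- + rr) (β≗β' (suc rr))))

  -- b = r₀ + 1 is a row index of g (1-based); the matrix rows r₀ and b (0-based) are g's rows b and b + 1.
  module Straightening (ℓ r₀ : ℕ) (r₀+2≤ℓ : suc (suc r₀) ≤ ℓ) where

    b : ℕ
    b = suc r₀

    G : Functional
    G = lower₁ (suc b) (g ℓ)

    G-ext : Extensional G
    G-ext = lower₁-ext (suc b) (g-ext ℓ)

    -- By kfun-difference, lowering β_{b+1} turns matrix row b, made of k^{(b)}, into one made of k^{(r₀)}.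
    GMatrix : Exponent → Matrix
    GMatrix β rr cc = if rr ≡ᵇ b then kfun r₀ ((β (suc b) ℤ.+ + cc) ℤ.- + b) else gMatrix β rr cc

    G-det : ∀ β → G β ≈ det ℓ (GMatrix β)
    G-det β = sym (det-linear ℓ b (GMatrix β) (gMatrix β) (gMatrix (shift β (suc b) -1ℤ)) r₀+2≤ℓ row-b other-rows)
      where
      row-b : ∀ cc → GMatrix β b cc ≈ gMatrix β b cc ⊖ gMatrix (shift β (suc b) -1ℤ) b cc
      row-b cc rewrite ≡ᵇ-refl b =
        trans (kfun-difference r₀ ((β (suc b) ℤ.+ + cc) ℤ.- + b)) (+-congˡ (-‿cong (kfun-cong b (exponent (β (suc b)) (+ cc) (+ b)))))
        where exponent : ∀ x c b → ((x ℤ.+ c) ℤ.- b) ℤ.+ -1ℤ ≡ ((x ℤ.+ -1ℤ) ℤ.+ c) ℤ.- b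
              exponent = solve-∀
      other-rows : ∀ rr → rr ≢ b → ∀ cc → GMatrix β rr cc ≈ gMatrix β rr cc × GMatrix β rr cc ≈ gMatrix (shift β (suc b) -1ℤ) rr cc
      other-rows rr rr≢b cc rewrite ≢⇒≡ᵇ-false rr≢b = refl , refl

    δ : ℕ → ℤ
    δ i = if i ≡ᵇ b then -1ℤ else (if i ≡ᵇ suc b then 1ℤ else 0ℤ)

    -- The straightening involution z^β ↦ z^{τβ} for the pair (b, b+1): (β_b, β_{b+1}) ↦ (β_{b+1} - 1, β_b + 1).
    τ : Exponent → Exponent
    τ β i = β (transpose b i) ℤ.+ δ i

    τ-b : ∀ β → τ β b ≡ β (suc b) ℤ.+ -1ℤ
    τ-b β rewrite ≡ᵇ-refl b = ≡.refl

    τ-1+b : ∀ β → τ β (suc b) ≡ β b ℤ.+ 1ℤ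
    τ-1+b β rewrite ≢⇒≡ᵇ-false (ℕₚ.1+n≢n {b}) | ≡ᵇ-refl b = ≡.refl

    τ-other : ∀ β {i} → i ≢ b → i ≢ suc b → τ β i ≡ β i
    τ-other β i≢b i≢1+b rewrite ≢⇒≡ᵇ-false i≢b | ≢⇒≡ᵇ-false i≢1+b = ℤₚ.+-identityʳ _

    τ-shift : ∀ β a d → τ (shift β a d) ≗ shift (τ β) (transpose b a) d
    τ-shift β a d i rewrite shift-≡ᵇ β a d (transpose b i) | shift-≡ᵇ (τ β) (transpose b a) d i | transpose-≡ᵇ b i a
      with i ≡ᵇ transpose b a
    ... | true  = ℤ+ₚ.xy∙z≈xz∙y (β (transpose b i)) d (δ i)
    ... | false = ≡.trans (≡.cong (ℤ._+ δ i) (ℤₚ.+-identityʳ (β (transpose b i)))) (≡.sym (ℤₚ.+-identityʳ (τ β i)))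

    τ-raiseBy : ∀ β α k → τ (raiseBy β α k) ≗ raiseBy (τ β) (transpose b (proj₁ α) , transpose b (proj₂ α)) k
    τ-raiseBy β (a , a') k = ≗-trans (τ-shift (shift β a (+ k)) a' _) (shift-cong (transpose b a') _ (τ-shift β a (+ k)))

    τ-fixed : ∀ β → β b ≡ β (suc b) ℤ.+ -1ℤ → τ β ≗ β
    τ-fixed β β-b i with i ℕ.≟ b
    ... | yes ≡.refl = ≡.trans (τ-b β) (≡.sym β-b)
    ... | no i≢b with i ℕ.≟ suc b
    ...   | yes ≡.refl = ≡.trans (τ-1+b β) (≡.trans (≡.cong (ℤ._+ 1ℤ) β-b) (cancel (β (suc b))))
      where cancel : ∀ x → (x ℤ.+ -1ℤ) ℤ.+ 1ℤ ≡ x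
            cancel = solve-∀
    ...   | no i≢1+b = τ-other β i≢b i≢1+b

    GMatrix-τ : ∀ β rr cc → GMatrix (τ β) rr cc ≈ swapRows r₀ (GMatrix β) rr cc
    GMatrix-τ β rr cc with rr ℕ.≟ r₀
    ... | yes ≡.refl rewrite ≢⇒≡ᵇ-false ((ℕₚ.<⇒≢ (ℕₚ.n<1+n rr))) | ≡ᵇ-refl rr =
      kfun-cong rr (exponent (β (suc (suc rr))) (+ cc) (+ rr))
      where exponent : ∀ x c r → ((x ℤ.+ -1ℤ) ℤ.+ c) ℤ.- r ≡ (x ℤ.+ c) ℤ.- (1ℤ ℤ.+ r)
            exponent = solve-∀
    ... | no rr≢r₀ with rr ℕ.≟ b
    ...   | yes ≡.refl rewrite ≢⇒≡ᵇ-false rr≢r₀ | ≡ᵇ-refl rr | ≢⇒≡ᵇ-false (ℕₚ.<⇒≢ (ℕₚ.n<1+n r₀)) =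
      kfun-cong r₀ (exponent (β (suc r₀)) (+ cc) (+ r₀))
      where exponent : ∀ x c r → ((x ℤ.+ 1ℤ) ℤ.+ c) ℤ.- (1ℤ ℤ.+ r) ≡ (x ℤ.+ c) ℤ.- r
            exponent = solve-∀
    ...   | no rr≢b rewrite ≢⇒≡ᵇ-false rr≢r₀ | ≢⇒≡ᵇ-false rr≢b =
      kfun-cong rr (≡.cong (λ t → (t ℤ.+ + cc) ℤ.- + rr) (ℤₚ.+-identityʳ (β (suc rr))))

    G-τ : ∀ β → G (τ β) ≈ ⊝ G β
    G-τ β = begin
      G (τ β)                           ≈⟨ G-det (τ β) ⟩
      det ℓ (GMatrix (τ β))             ≈⟨ det-cong ℓ (GMatrix-τ β) ⟩
      det ℓ (swapRows r₀ (GMatrix β))   ≈⟨ det-swapRows ℓ r₀ (GMatrix β) r₀+2≤ℓ ⟩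
      ⊝ det ℓ (GMatrix β)               ≈⟨ -‿cong (sym (G-det β)) ⟩
      ⊝ G β                             ∎

    G-fixed : ∀ β → β b ≡ β (suc b) ℤ.+ -1ℤ → G β ≈ 0#
    G-fixed β β-b = trans (G-det β) (det-equalRows ℓ r₀ (GMatrix β) r₀+2≤ℓ equal)
      where
      equal : ∀ cc → GMatrix β r₀ cc ≈ GMatrix β (suc r₀) cc
      equal cc rewrite ≢⇒≡ᵇ-false ((ℕₚ.<⇒≢ (ℕₚ.n<1+n r₀))) | ≡ᵇ-refl b =
        kfun-cong r₀ (≡.trans (≡.cong (λ t → (t ℤ.+ + cc) ℤ.- + r₀) β-b) (exponent (β (suc b)) (+ cc) (+ r₀)))
        where exponent : ∀ x c r → ((x ℤ.+ -1ℤ) ℤ.+ c) ℤ.- r ≡ (x ℤ.+ c) ℤ.- (1ℤ ℤ.+ r)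
              exponent = solve-∀

    _<ℤᵇ_ : ℤ → ℤ → Bool
    x <ℤᵇ y = ⌊ x ℤ.<? y ⌋

    <⇒<ℤᵇ-true : ∀ {x y} → x ℤ.< y → (x <ℤᵇ y) ≡ true
    <⇒<ℤᵇ-true {x} {y} x<y with x ℤ.<? y
    ... | yes _   = ≡.refl
    ... | no  x≮y = ⊥-elim (x≮y x<y)

    ≮⇒<ℤᵇ-false : ∀ {x y} → ¬ (x ℤ.< y) → (x <ℤᵇ y) ≡ false
    ≮⇒<ℤᵇ-false {x} {y} x≮y with x ℤ.<? y
    ... | yes x<y = ⊥-elim (x≮y x<y)
    ... | no  _   = ≡.refl

    -- G restricted to the exponents with β_{b+1} - 1 < β_b; G = H - H ∘ τ since τ swaps the two strict sides.
    H : Functional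
    H β = if (β (suc b) ℤ.+ -1ℤ) <ℤᵇ β b then G β else 0#

    H-ext : Extensional H
    H-ext {β} {β'} β≗β' rewrite β≗β' (suc b) | β≗β' b with (β' (suc b) ℤ.+ -1ℤ) <ℤᵇ β' b
    ... | true  = G-ext β≗β'
    ... | false = refl

    τ-1+b-1 : ∀ β → τ β (suc b) ℤ.+ -1ℤ ≡ β b
    τ-1+b-1 β = ≡.trans (≡.cong (ℤ._+ -1ℤ) (τ-1+b β)) (cancel (β b))
      where cancel : ∀ x → (x ℤ.+ 1ℤ) ℤ.+ -1ℤ ≡ x
            cancel = solve-∀

    G≈H-H∘τ : ∀ β → G β ≈ H β ⊖ H (τ β)
    G≈H-H∘τ β with ℤₚ.<-cmp (β (suc b) ℤ.+ -1ℤ) (β b)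
    ... | tri< lt _ ¬gt rewrite <⇒<ℤᵇ-true lt | τ-1+b-1 β | τ-b β | ≮⇒<ℤᵇ-false ¬gt = sym (x⊖0≈x _)
    ... | tri≈ ¬lt eq ¬gt rewrite ≮⇒<ℤᵇ-false ¬lt | τ-1+b-1 β | τ-b β | ≮⇒<ℤᵇ-false ¬gt =
      trans (G-fixed β (≡.sym eq)) (sym (x⊖0≈x _))
    ... | tri> ¬lt _ gt rewrite ≮⇒<ℤᵇ-false ¬lt | τ-1+b-1 β | τ-b β | <⇒<ℤᵇ-true gt =
      sym (trans (+-identityˡ _) (trans (-‿cong (G-τ β)) (-‿involutive _)))

    raise-lowering-τ : ∀ N Ψ m γ → (∀ i j → Ψ i j ≡ true → i < j) → (∀ i j → Ψ (transpose b i) (transpose b j) ≡ Ψ i j) →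
      (∀ c → m (transpose b c) ≡ m c) → τ γ ≗ γ → ∀ {F} → Extensional F →
      raise N (rootsOf ℓ Ψ) γ (lowering (interval 1 ℓ) m (F ∘ τ)) ≈ raise N (rootsOf ℓ Ψ) γ (lowering (interval 1 ℓ) m F)
    raise-lowering-τ N Ψ m γ strict invariant m-invariant γ-fixed {F} F-ext = begin
      raise N rs γ (lowering I m (F ∘ τ))      ≈⟨ raise-cong N rs lowering-τ γ ⟩
      raise N rs γ (L ∘ τ)                     ≈⟨ raise-conj N τ (transpose² b) rs (λ α _ β k → τ-raiseBy β α k) L-ext γ ⟩
      raise N (map (transpose² b) rs) (τ γ) L  ≈⟨ raise-↭ N (map-transpose²-roots-↭ ℓ Ψ b (s≤s z≤n) r₀+2≤ℓ strict invariant) L-ext (τ γ) ⟩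
      raise N rs (τ γ) L                       ≈⟨ raise-ext N rs L-ext γ-fixed ⟩
      raise N rs γ L                           ∎
      where
      I : List ℕ
      I = interval 1 ℓ
      rs : List (ℕ × ℕ)
      rs = rootsOf ℓ Ψ
      L : Functional
      L = lowering I m F
      L-ext : Extensional L
      L-ext = lowering-ext I m F-ext
      lowering-τ : ∀ β → lowering I m (F ∘ τ) β ≈ L (τ β)
      lowering-τ β = trans (lowering-conj τ (transpose b) I m m (λ c _ β s → τ-shift β c _) (λ c _ → m-invariant c) F-ext β)
                           (lowering-↭ (map-transpose-interval ℓ b (s≤s z≤n) r₀+2≤ℓ) m F-ext (τ β))

  -- Peeling one factor (1 - 1/z_{b+1}) makes the multiplicities symmetric in b, b + 1, and
  -- g (1 - 1/z_{b+1}) = H - H ∘ τ; by the τ-symmetry of the data the two halves cancel.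
  Ktrunc-straightening-vanishes : ∀ ℓ N Ψ m γ b → 1 ≤ b → suc b ≤ ℓ →
    (∀ i j → Ψ i j ≡ true → i < j) → (∀ i j → Ψ (transpose b i) (transpose b j) ≡ Ψ i j) →
    m (suc b) ≡ suc (m b) → γ b ≡ γ (suc b) ℤ.+ -1ℤ →
    Ktrunc ℓ N Ψ m γ ≈ 0#
  Ktrunc-straightening-vanishes ℓ N Ψ m γ (suc r₀) _ b+1≤ℓ strict invariant m[b+1] γ[b] = begin
    Ktrunc ℓ N Ψ m γ
      ≈⟨ Ktrunc≈raise-lowering ℓ N Ψ m γ ⟩
    raise N rs γ (lowering I m (g ℓ))
      ≈⟨ raise-cong N rs (lowering-interval-peel ℓ (suc b) m m′ (g-ext ℓ) (s≤s z≤n) b+1≤ℓ m≡m′ m[b+1]′) γ ⟩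
    raise N rs γ (lowering I m′ G)
      ≈⟨ raise-cong N rs (λ β → trans (lowering-cong I m′ G≈H-H∘τ β) (lowering-⊖ I m′ H (H ∘ τ) β)) γ ⟩
    raise N rs γ (λ β → lowering I m′ H β ⊖ lowering I m′ (H ∘ τ) β)
      ≈⟨ raise-⊖ N rs (lowering I m′ H) _ γ ⟩
    raise N rs γ (lowering I m′ H) ⊖ raise N rs γ (lowering I m′ (H ∘ τ))
      ≈⟨ +-congˡ (-‿cong (raise-lowering-τ N Ψ m′ γ strict invariant (transpose-respects m′ b m′[b]≡m′[b+1]) (τ-fixed γ γ[b]) H-ext)) ⟩
    raise N rs γ (lowering I m′ H) ⊖ raise N rs γ (lowering I m′ H)
      ≈⟨ -‿inverseʳ _ ⟩
    0# ∎
    where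
    open Straightening ℓ r₀ b+1≤ℓ
    I : List ℕ
    I = interval 1 ℓ
    rs : List (ℕ × ℕ)
    rs = rootsOf ℓ Ψ
    m′ : ℕ → ℕ
    m′ j = if j ≡ᵇ suc b then m b else m j
    m≡m′ : ∀ j → j ≢ suc b → m j ≡ m′ j
    m≡m′ j j≢b+1 rewrite ≢⇒≡ᵇ-false j≢b+1 = ≡.refl
    m[b+1]′ : m (suc b) ≡ suc (m′ (suc b))
    m[b+1]′ rewrite ≡ᵇ-refl b = m[b+1]
    m′[b]≡m′[b+1] : m′ b ≡ m′ (suc b)
    m′[b]≡m′[b+1] rewrite ≢⇒≡ᵇ-false (ℕₚ.<⇒≢ (ℕₚ.n<1+n b)) | ≡ᵇ-refl b = ≡.refl

  -- Support of g

  suffixSum-shift : ∀ b n β c d → suffixSum b n (shift β c d) ≡ suffixSum b n β ℤ.+ indicator b n c ℤ.* d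
  suffixSum-shift b zero    β c d = ≡.refl
  suffixSum-shift b (suc n) β c d rewrite shift-≡ᵇ β c d b | suffixSum-shift (suc b) n β c d with b ≡ᵇ c
  ... | true  = regroup (β b) d (suffixSum (suc b) n β) (indicator (suc b) n c)
    where regroup : ∀ x d s t → (x ℤ.+ d) ℤ.+ (s ℤ.+ t ℤ.* d) ≡ (x ℤ.+ s) ℤ.+ (1ℤ ℤ.+ t) ℤ.* d
          regroup = solve-∀
  ... | false = regroup (β b) d (suffixSum (suc b) n β) (indicator (suc b) n c)
    where regroup : ∀ x d s t → (x ℤ.+ 0ℤ) ℤ.+ (s ℤ.+ t ℤ.* d) ≡ (x ℤ.+ s) ℤ.+ (0ℤ ℤ.+ t) ℤ.* d
          regroup = solve-∀

  suffixSum-lower : ∀ b n β c s → suffixSum b n (shift β c (ℤ.- (+ s))) ≼ suffixSum b n β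
  suffixSum-lower b n β c s with indicator-0∨1 b n c
  ... | inj₁ χ≡0 = 0 , ≡.trans (ℤₚ.+-identityʳ _) (≡.trans (suffixSum-shift b n β c _)
                     (≡.trans (≡.cong (λ t → suffixSum b n β ℤ.+ t ℤ.* ℤ.- (+ s)) χ≡0) (ℤₚ.+-identityʳ _)))
  ... | inj₂ χ≡1 = s , ≡.trans (≡.cong (ℤ._+ + s) (≡.trans (suffixSum-shift b n β c _)
                     (≡.cong (λ t → suffixSum b n β ℤ.+ t ℤ.* ℤ.- (+ s)) χ≡1))) (cancel (suffixSum b n β) (+ s))
    where cancel : ∀ x s → (x ℤ.+ 1ℤ ℤ.* ℤ.- s) ℤ.+ s ≡ x
          cancel = solve-∀

  suffixSum-raiseBy : ∀ b n β a' b' k → suffixSum b n (raiseBy β (a' , b') k) ≡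
    (suffixSum b n β ℤ.+ indicator b n a' ℤ.* + k) ℤ.+ indicator b n b' ℤ.* ℤ.- (+ k)
  suffixSum-raiseBy b n β a' b' k =
    ≡.trans (suffixSum-shift b n _ b' _) (≡.cong (λ u → u ℤ.+ indicator b n b' ℤ.* ℤ.- (+ k)) (suffixSum-shift b n β a' (+ k)))

  suffixSum-raiseBy-≼ : ∀ b n β a' b' k → a' < b' → b' < b + n → suffixSum b n (raiseBy β (a' , b') k) ≼ suffixSum b n β
  suffixSum-raiseBy-≼ b n β a' b' k a'<b' b'<b+n with b' ℕ.<? b
  ... | yes b'<b rewrite suffixSum-raiseBy b n β a' b' k | indicator-below b n b' b'<b | indicator-below b n a' (ℕₚ.<-trans a'<b' b'<b) =
    0 , cancel (suffixSum b n β) (+ k)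
    where cancel : ∀ x k → ((x ℤ.+ 0ℤ ℤ.* k) ℤ.+ 0ℤ ℤ.* ℤ.- k) ℤ.+ 0ℤ ≡ x
          cancel = solve-∀
  ... | no b'≮b rewrite suffixSum-raiseBy b n β a' b' k | indicator-in b n b' (ℕₚ.≮⇒≥ b'≮b) b'<b+n with indicator-0∨1 b n a'
  ...   | inj₁ χ≡0 rewrite χ≡0 = k , cancel (suffixSum b n β) (+ k)
    where cancel : ∀ x k → ((x ℤ.+ 0ℤ ℤ.* k) ℤ.+ 1ℤ ℤ.* ℤ.- k) ℤ.+ k ≡ x
          cancel = solve-∀
  ...   | inj₂ χ≡1 rewrite χ≡1 = 0 , cancel (suffixSum b n β) (+ k)
    where cancel : ∀ x k → ((x ℤ.+ 1ℤ ℤ.* k) ℤ.+ 1ℤ ℤ.* ℤ.- k) ℤ.+ 0ℤ ≡ x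
          cancel = solve-∀

  suffixSum-raiseBy-pinned : ∀ b n β a k → a < b → 0 < n → suffixSum b n (raiseBy β (a , b) k) ℤ.+ + k ≡ suffixSum b n β
  suffixSum-raiseBy-pinned b n β a k a<b 0<n
    rewrite suffixSum-raiseBy b n β a b k | indicator-below b n a a<b | indicator-in b n b ℕₚ.≤-refl (ℕₚ.m<m+n b 0<n) =
    cancel (suffixSum b n β) (+ k)
    where cancel : ∀ x k → ((x ℤ.+ 0ℤ ℤ.* k) ℤ.+ 1ℤ ℤ.* ℤ.- k) ℤ.+ k ≡ x
          cancel = solve-∀

  VanishesBelow : ℕ → ℕ → ℤ → Functional → Set r
  VanishesBelow b n c Φ = ∀ β → suffixSum b n β ≺ c → Φ β ≈ 0#

  raise-vanishesBelow : ∀ N b n c rs {Φ} → All (λ α → proj₁ α < proj₂ α × proj₂ α < b + n) rs →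
    VanishesBelow b n c Φ → VanishesBelow b n c (λ β → raise N rs β Φ)
  raise-vanishesBelow N b n c []                []                       Φ≈0 β β≺c = Φ≈0 β β≺c
  raise-vanishesBelow N b n c ((a' , b') ∷ rs) ((a'<b' , b'<b+n) ∷ ok) Φ≈0 β β≺c =
    sumR-zero (suc N) (λ k _ → raise-vanishesBelow N b n c rs ok Φ≈0 _
      (≼-≺-trans {suffixSum b n (raiseBy β (a' , b') k)} (suffixSum-raiseBy-≼ b n β a' b' k a'<b' b'<b+n) β≺c))

  lowering-vanishesBelow : ∀ b n c bs m {Φ} → VanishesBelow b n c Φ → VanishesBelow b n c (lowering bs m Φ)
  lowering-vanishesBelow b n c []        m Φ≈0 β β≺c = Φ≈0 β β≺c
  lowering-vanishesBelow b n c (b' ∷ bs) m Φ≈0 β β≺c =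
    sumR-zero (suc (m b')) (λ s _ → trans (*-congˡ (trans (*-congˡ (lowering-vanishesBelow b n c bs m Φ≈0 _
      (≼-≺-trans {suffixSum b n (shift β b' (ℤ.- (+ s)))} (suffixSum-lower b n β b' s) β≺c))) (zeroʳ _))) (zeroʳ _))

  -- Row j of g's matrix then consists of k^{(j-1)}_n with n < 0, which are 0.
  g-negative-entry : ∀ ℓ β j → 1 ≤ j → j ≤ ℓ → ∀ q → β j ℤ.+ + ℓ ≡ -[1+ q ] → g ℓ β ≈ 0#
  g-negative-entry ℓ β (suc rr) _ j≤ℓ q β[j]+ℓ<0 = det-zero-row ℓ (gMatrix β) rr j≤ℓ row-zero
    where
    negative : ∀ x k q → x ℤ.+ + k ≡ -[1+ q ] → ∃ λ q' → x ≡ -[1+ q' ]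
    negative -[1+ p ] k q _ = p , ≡.refl
    row-zero : ∀ cc → cc < ℓ → kfun rr ((β (suc rr) ℤ.+ + cc) ℤ.- + rr) ≈ 0#
    row-zero cc cc<ℓ with ℕₚ.m≤n⇒∃[o]m+o≡n cc<ℓ
    ... | e , 1+cc+e≡ℓ with negative ((β (suc rr) ℤ.+ + cc) ℤ.- + rr) (e ℕ.+ rr) (suc q)
          (≡.trans (regroup (β (suc rr)) (+ cc) (+ e) (+ rr))
          (≡.trans (≡.cong (λ t → β (suc rr) ℤ.+ + t ℤ.+ -1ℤ) 1+cc+e≡ℓ)
          (≡.trans (≡.cong (ℤ._+ -1ℤ) β[j]+ℓ<0) (≡.cong (λ t → -[1+ suc t ]) (ℕₚ.+-identityʳ q)))))
      where regroup : ∀ x c e r → ((x ℤ.+ c) ℤ.- r) ℤ.+ (e ℤ.+ r) ≡ x ℤ.+ (1ℤ ℤ.+ c ℤ.+ e) ℤ.+ -1ℤ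
            regroup = solve-∀
    ...   | q' , entry<0 rewrite entry<0 = refl

  g-vanishesBelow : ∀ ℓ b n → 1 ≤ b → b + n ≤ suc ℓ → VanishesBelow b n (ℤ.- (+ (n ℕ.* ℓ))) (g ℓ)
  g-vanishesBelow ℓ b n 1≤b b+n≤1+ℓ β β≺ with suffixSum-pigeonhole b n β ℓ β≺
  ... | j , b≤j , j<b+n , q , β[j]+ℓ<0 = g-negative-entry ℓ β j (ℕₚ.≤-trans 1≤b b≤j) (ℕₚ.≤-pred (ℕₚ.≤-trans j<b+n b+n≤1+ℓ)) q β[j]+ℓ<0

  -- Removing one root

  raiseBy-zero : ∀ γ α → raiseBy γ α 0 ≗ γ
  raiseBy-zero γ (a , b) = ≗-trans (shift-zero _ b) (shift-zero γ a)

  raiseBy-+ : ∀ γ α s t → raiseBy (raiseBy γ α s) α t ≗ raiseBy γ α (s + t)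
  raiseBy-+ γ (a , b) s t =
    ≗-trans (shift-cong b _ (shift-comm (shift γ a (+ s)) b (ℤ.- (+ s)) a (+ t)))
    (≗-trans (shift-+ (shift (shift γ a (+ s)) a (+ t)) b (ℤ.- (+ s)) (ℤ.- (+ t)))
    (≗-trans (shift-cong b _ (shift-+ γ a (+ s) (+ t)))
             (λ i → ≡.cong (λ d → shift (shift γ a (+ (s + t))) b d i) (≡.sym (ℤₚ.neg-distrib-+ (+ s) (+ t))))))

  raiseBy-lower-target : ∀ γ a b k → shift (raiseBy γ (a , b) k) b -1ℤ ≗ shift (raiseBy γ (a , b) (suc k)) a -1ℤ
  raiseBy-lower-target γ a b k i
    rewrite shift-≡ᵇ (raiseBy γ (a , b) k) b -1ℤ i | shift-≡ᵇ (raiseBy γ (a , b) (suc k)) a -1ℤ i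
          | shift-≡ᵇ (shift γ a (+ k)) b (ℤ.- (+ k)) i | shift-≡ᵇ (shift γ a (+ suc k)) b (ℤ.- (+ suc k)) i
          | shift-≡ᵇ γ a (+ k) i | shift-≡ᵇ γ a (+ suc k) i
    with i ≡ᵇ a | i ≡ᵇ b
  ... | true  | true  = regroup (γ i) (+ k)
    where regroup : ∀ x k → ((x ℤ.+ k) ℤ.+ ℤ.- k) ℤ.+ -1ℤ ≡ ((x ℤ.+ (1ℤ ℤ.+ k)) ℤ.+ ℤ.- (1ℤ ℤ.+ k)) ℤ.+ -1ℤ
          regroup = solve-∀
  ... | true  | false = regroup (γ i) (+ k)
    where regroup : ∀ x k → ((x ℤ.+ k) ℤ.+ 0ℤ) ℤ.+ 0ℤ ≡ ((x ℤ.+ (1ℤ ℤ.+ k)) ℤ.+ 0ℤ) ℤ.+ -1ℤ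
          regroup = solve-∀
  ... | false | true  = regroup (γ i) (+ k)
    where regroup : ∀ x k → ((x ℤ.+ 0ℤ) ℤ.+ ℤ.- k) ℤ.+ -1ℤ ≡ ((x ℤ.+ 0ℤ) ℤ.+ ℤ.- (1ℤ ℤ.+ k)) ℤ.+ 0ℤ
          regroup = solve-∀
  ... | false | false = ≡.refl

  Ktrunc-ext : ∀ ℓ N Ψ m → Extensional (Ktrunc ℓ N Ψ m)
  Ktrunc-ext ℓ N Ψ m {β} {β'} β≗β' = begin
    Ktrunc ℓ N Ψ m β                                         ≈⟨ Ktrunc≈raise-lowering ℓ N Ψ m β ⟩
    raise N (rootsOf ℓ Ψ) β (lowering (interval 1 ℓ) m (g ℓ))  ≈⟨ raise-ext N (rootsOf ℓ Ψ) (lowering-ext (interval 1 ℓ) m (g-ext ℓ)) β≗β' ⟩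
    raise N (rootsOf ℓ Ψ) β' (lowering (interval 1 ℓ) m (g ℓ)) ≈⟨ Ktrunc≈raise-lowering ℓ N Ψ m β' ⟨
    Ktrunc ℓ N Ψ m β'                                        ∎

  Ktrunc-cong : ∀ ℓ N {Ψ Ψ' m m'} → (∀ i j → Ψ i j ≡ Ψ' i j) → (∀ j → m j ≡ m' j) → ∀ γ →
    Ktrunc ℓ N Ψ m γ ≈ Ktrunc ℓ N Ψ' m' γ
  Ktrunc-cong ℓ N {Ψ} {Ψ'} {m} {m'} Ψ≗Ψ' m≗m' γ = begin
    Ktrunc ℓ N Ψ m γ                                          ≈⟨ Ktrunc≈raise-lowering ℓ N Ψ m γ ⟩
    raise N (rootsOf ℓ Ψ) γ (lowering (interval 1 ℓ) m (g ℓ))   ≈⟨ raise-cong N (rootsOf ℓ Ψ) (lowering-cong-mult (interval 1 ℓ) m m' (λ j _ → m≗m' j)) γ ⟩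
    raise N (rootsOf ℓ Ψ) γ (lowering (interval 1 ℓ) m' (g ℓ))  ≡⟨ ≡.cong (λ rs → raise N rs γ (lowering (interval 1 ℓ) m' (g ℓ))) (roots-cong ℓ Ψ≗Ψ') ⟩
    raise N (rootsOf ℓ Ψ') γ (lowering (interval 1 ℓ) m' (g ℓ)) ≈⟨ Ktrunc≈raise-lowering ℓ N Ψ' m' γ ⟨
    Ktrunc ℓ N Ψ' m' γ                                        ∎

  module _ (ℓ : ℕ) (Ψ : RootSet) (a b : ℕ) (1≤a : 1 ≤ a) (a<b : a < b) (b≤ℓ : b ≤ ℓ)
           (Ψ⊆Δ : ∀ i j → Ψ i j ≡ true → i < j × j ≤ ℓ) (ab∈Ψ : Ψ a b ≡ true) where

    private
      Ψ′ : RootSet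
      Ψ′ = removeRoot a b Ψ

      1≤b : 1 ≤ b
      1≤b = ℕₚ.<-≤-trans (s≤s z≤n) a<b

      b≢a : b ≢ a
      b≢a = ℕₚ.>⇒≢ a<b

      1+b≢a : suc b ≢ a
      1+b≢a = ℕₚ.>⇒≢ (ℕₚ.m<n⇒m<1+n a<b)

    -- Expanding the geometric series of the root (a, b) and one factor (1 - 1/z_k) of M.
    Ktrunc-expand-root : ∀ N k m μ' → 1 ≤ k → k ≤ ℓ → (∀ j → j ≢ k → m j ≡ μ' j) → m k ≡ suc (μ' k) →
      ∀ β → Ktrunc ℓ N Ψ m β ≈ sumR (suc N) (λ t → lower₁ k (Ktrunc ℓ N Ψ′ μ') (raiseBy β (a , b) t))
    Ktrunc-expand-root N k m μ' 1≤k k≤ℓ m≡μ' m[k] β = begin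
      Ktrunc ℓ N Ψ m β
        ≈⟨ Ktrunc≈raise-lowering ℓ N Ψ m β ⟩
      raise N (rootsOf ℓ Ψ) β (lowering I m (g ℓ))
        ≈⟨ raise-cong N (rootsOf ℓ Ψ) (λ β' → trans (lowering-interval-peel ℓ k m μ' (g-ext ℓ) 1≤k k≤ℓ m≡μ' m[k] β')
                                                     (lowering-lower₁ I μ' k (g-ext ℓ) β')) β ⟩
      raise N (rootsOf ℓ Ψ) β (lower₁ k Φ)
        ≈⟨ raise-↭ N (roots-removeRoot-↭ ℓ Ψ a b ab∈Ψ 1≤a a<b b≤ℓ) (lower₁-ext k Φ-ext) β ⟩
      sumR (suc N) (λ t → raise N (rootsOf ℓ Ψ′) (raiseBy β (a , b) t) (lower₁ k Φ))
        ≈⟨ sumR-cong (suc N) (λ t → trans (raise-lower₁ N (rootsOf ℓ Ψ′) k Φ-ext _)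
             (⊖-cong (sym (Ktrunc≈raise-lowering ℓ N Ψ′ μ' _)) (sym (Ktrunc≈raise-lowering ℓ N Ψ′ μ' _)))) ⟩
      sumR (suc N) (λ t → lower₁ k (Ktrunc ℓ N Ψ′ μ') (raiseBy β (a , b) t)) ∎
      where
      I : List ℕ
      I = interval 1 ℓ
      Φ : Functional
      Φ = lowering I μ' (g ℓ)
      Φ-ext : Extensional Φ
      Φ-ext = lowering-ext I μ' (g-ext ℓ)

    -- Raising along (a, b) lowers the sum of the exponents in columns b, …, ℓ, where g is eventually 0.
    Ktrunc-raiseBy-eventually-zero : ∀ μ' γ → ∃ λ N₀ → ∀ N → N₀ ≤ N → Ktrunc ℓ N Ψ′ μ' (raiseBy γ (a , b) (suc N)) ≈ 0#
    Ktrunc-raiseBy-eventually-zero μ' γ = proj₁ bound , λ N N₀≤N → trans (Ktrunc≈raise-lowering ℓ N Ψ′ μ' _)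
      (raise-vanishesBelow N b n _ (rootsOf ℓ Ψ′) (All.tabulate bounded)
         (lowering-vanishesBelow b n _ (interval 1 ℓ) μ' (g-vanishesBelow ℓ b n 1≤b (ℕₚ.≤-reflexive b+n≡1+ℓ)))
         _ (proj₂ bound N N₀≤N (suffixSum b n (raiseBy γ (a , b) (suc N))) (suffixSum-raiseBy-pinned b n γ a (suc N) a<b 0<n)))
      where
      n : ℕ
      n = suc ℓ ∸ b
      bound : ∃ λ N₀ → ∀ N → N₀ ≤ N → ∀ x → x ℤ.+ + suc N ≡ suffixSum b n γ → x ≺ ℤ.- (+ (n ℕ.* ℓ))
      bound = eventually-≺ (suffixSum b n γ) (ℤ.- (+ (n ℕ.* ℓ)))
      b+n≡1+ℓ : b + n ≡ suc ℓ
      b+n≡1+ℓ = ℕₚ.m+[n∸m]≡n (ℕₚ.m≤n⇒m≤1+n b≤ℓ)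
      0<n : 0 < n
      0<n = ℕₚ.m<n⇒0<n∸m (s≤s b≤ℓ)
      bounded : ∀ {α} → α ∈ rootsOf ℓ Ψ′ → proj₁ α < proj₂ α × proj₂ α < b + n
      bounded {i , j} α∈ with Ψ⊆Δ i j (∧-true⇒trueˡ (∈-roots⁻ ℓ Ψ′ α∈))
      ... | i<j , j≤ℓ = i<j , ≡.subst (j <_) (≡.sym b+n≡1+ℓ) (s≤s j≤ℓ)

    -- Σ_t (1 - 1/z_a) F(β + t(e_a - e_b)) is itself a K(Ψ; M' + e_a; β), and one to which straightening applies.
    sumR-lower₁-source-vanishes : ∀ N μ' β → suc b ≤ ℓ → (∀ i j → Ψ (transpose b i) (transpose b j) ≡ Ψ i j) →
      μ' (suc b) ≡ suc (μ' b) → β b ≡ β (suc b) ℤ.+ -1ℤ →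
      sumR (suc N) (λ t → lower₁ a (Ktrunc ℓ N Ψ′ μ') (raiseBy β (a , b) t)) ≈ 0#
    sumR-lower₁-source-vanishes N μ' β b<ℓ invariant μ'[b+1] β[b] = begin
      sumR (suc N) (λ t → lower₁ a (Ktrunc ℓ N Ψ′ μ') (raiseBy β (a , b) t))
        ≈⟨ Ktrunc-expand-root N a μ₂ μ' 1≤a (ℕₚ.<⇒≤ (ℕₚ.<-≤-trans a<b b≤ℓ))
             (λ j j≢a → ≡.cong (λ c → if c then suc (μ' a) else μ' j) (≢⇒≡ᵇ-false j≢a))
             (≡.cong (λ c → if c then suc (μ' a) else μ' a) (≡ᵇ-refl a)) β ⟨
      Ktrunc ℓ N Ψ μ₂ β
        ≈⟨ Ktrunc-straightening-vanishes ℓ N Ψ μ₂ β b 1≤b b<ℓ (λ i j → proj₁ ∘ Ψ⊆Δ i j) invariant μ₂[b+1] β[b] ⟩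
      0# ∎
      where
      μ₂ : ℕ → ℕ
      μ₂ j = if j ≡ᵇ a then suc (μ' a) else μ' j
      μ₂[b+1] : μ₂ (suc b) ≡ suc (μ₂ b)
      μ₂[b+1] rewrite ≢⇒≡ᵇ-false 1+b≢a | ≢⇒≡ᵇ-false b≢a = μ'[b+1]

    -- Telescoping of F = K(Ψ ∖ (a, b); M') along γ_t = γ + t(e_a - e_b), using γ_t - e_b = γ_{t+1} - e_a.
    Ktrunc-removeRoot-telescope : ∀ N μ μ' γ → suc b ≤ ℓ → (∀ i j → Ψ (transpose b i) (transpose b j) ≡ Ψ i j) →
      μ (suc b) ≡ μ b → μ b ≡ suc (μ' b) → (∀ j → j ≢ b → μ j ≡ μ' j) → γ b ≡ γ (suc b) →
      Ktrunc ℓ N Ψ′ μ' (raiseBy γ (a , b) (suc N)) ≈ 0# → Ktrunc ℓ N Ψ μ γ ≈ Ktrunc ℓ N Ψ′ μ' γ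
    Ktrunc-removeRoot-telescope N μ μ' γ b<ℓ invariant μ[b+1] μ[b] μ≡μ' γ[b] tail≈0 = begin
      Ktrunc ℓ N Ψ μ γ
        ≈⟨ Ktrunc-expand-root N b μ μ' 1≤b b≤ℓ μ≡μ' μ[b] γ ⟩
      sumR (suc N) (λ t → F (γₜ t) ⊖ F (shift (γₜ t) b -1ℤ))
        ≈⟨ sumR-⊖ (suc N) _ _ ⟩
      sumR (suc N) (F ∘ γₜ) ⊖ sumR (suc N) (λ t → F (shift (γₜ t) b -1ℤ))
        ≈⟨ ⊖-cong telescope (sumR-cong (suc N) (λ t → F-ext (raiseBy-lower-target γ a b t))) ⟩
      (F γ ⊕ sumR (suc N) (λ t → F (γₜ (suc t)))) ⊖ sumR (suc N) (λ t → F (shift (γₜ (suc t)) a -1ℤ))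
        ≈⟨ trans (+-assoc _ _ _) (+-congˡ (sym (sumR-⊖ (suc N) _ _))) ⟩
      F γ ⊕ sumR (suc N) (λ t → lower₁ a F (γₜ (suc t)))
        ≈⟨ +-congˡ (sumR-cong (suc N) (λ t → lower₁-ext a F-ext (raiseBy-+ γ (a , b) 1 t))) ⟨
      F γ ⊕ sumR (suc N) (λ t → lower₁ a F (raiseBy (γₜ 1) (a , b) t))
        ≈⟨ +-congˡ (sumR-lower₁-source-vanishes N μ' (γₜ 1) b<ℓ invariant μ'[b+1] γ₁[b]) ⟩
      F γ ⊕ 0#
        ≈⟨ +-identityʳ _ ⟩
      F γ ∎
      where
      F : Functional
      F = Ktrunc ℓ N Ψ′ μ'
      F-ext : Extensional F
      F-ext = Ktrunc-ext ℓ N Ψ′ μ'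
      γₜ : ℕ → Exponent
      γₜ = raiseBy γ (a , b)
      telescope : sumR (suc N) (F ∘ γₜ) ≈ F γ ⊕ sumR (suc N) (λ t → F (γₜ (suc t)))
      telescope = begin
        sumR (suc N) (F ∘ γₜ)                          ≈⟨ trans (sym (+-identityʳ _)) (+-congˡ (sym tail≈0)) ⟩
        sumR (suc (suc N)) (F ∘ γₜ)                    ≈⟨ sumR-head (suc N) (F ∘ γₜ) ⟩
        F (γₜ 0) ⊕ sumR (suc N) (λ t → F (γₜ (suc t))) ≈⟨ +-congʳ (F-ext (raiseBy-zero γ (a , b))) ⟩
        F γ ⊕ sumR (suc N) (λ t → F (γₜ (suc t)))      ∎
      μ'[b+1] : μ' (suc b) ≡ suc (μ' b)
      μ'[b+1] = ≡.trans (≡.sym (μ≡μ' (suc b) ℕₚ.1+n≢n)) (≡.trans μ[b+1] μ[b])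
      γ₁[b] : γₜ 1 b ≡ γₜ 1 (suc b) ℤ.+ -1ℤ
      γ₁[b] = ≡.trans (shift-here (shift γ a (+ 1)) b -1ℤ) (≡.cong (ℤ._+ -1ℤ)
        (≡.trans (≡.trans (shift-other γ a (+ 1) b≢a) γ[b])
                 (≡.sym (≡.trans (shift-other (shift γ a (+ 1)) b -1ℤ ℕₚ.1+n≢n) (shift-other γ a (+ 1) 1+b≢a)))))

    Ktrunc-removeRoot : ∀ μ μ' γ → suc b ≤ ℓ → (∀ i j → Ψ (transpose b i) (transpose b j) ≡ Ψ i j) →
      μ (suc b) ≡ μ b → μ b ≡ suc (μ' b) → (∀ j → j ≢ b → μ j ≡ μ' j) → γ b ≡ γ (suc b) →
      ∃ λ N₀ → ∀ N → N₀ ≤ N → Ktrunc ℓ N Ψ μ γ ≈ Ktrunc ℓ N Ψ′ μ' γ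
    Ktrunc-removeRoot μ μ' γ b<ℓ invariant μ[b+1] μ[b] μ≡μ' γ[b] =
      proj₁ (Ktrunc-raiseBy-eventually-zero μ' γ) , λ N N₀≤N →
        Ktrunc-removeRoot-telescope N μ μ' γ b<ℓ invariant μ[b+1] μ[b] μ≡μ' γ[b] (proj₂ (Ktrunc-raiseBy-eventually-zero μ' γ) N N₀≤N)

-- Root ideals and diagonals

inDiag-true⇒ : ∀ X Y w i j → inDiag X Y w i j ≡ true → j + X ≡ i + Y × Y ≤ j × j ≤ w
inDiag-true⇒ X Y w i j e  with j + X ≡ᵇ i + Y in e₁ | Y ≤ᵇ j in e₂ | j ≤ᵇ w in e₃
inDiag-true⇒ X Y w i j e  | true  | true  | true  = ≡ᵇ-true⇒≡ e₁ , ≤ᵇ-true⇒≤ e₂ , ≤ᵇ-true⇒≤ e₃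
inDiag-true⇒ X Y w i j () | true  | true  | false
inDiag-true⇒ X Y w i j () | true  | false | _
inDiag-true⇒ X Y w i j () | false | _     | _

inDiag-true⇐ : ∀ X Y w i j → j + X ≡ i + Y → Y ≤ j → j ≤ w → inDiag X Y w i j ≡ true
inDiag-true⇐ X Y w i j e Y≤j j≤w rewrite e | ≡ᵇ-refl (i + Y) | ≤⇒≤ᵇ-true Y≤j | ≤⇒≤ᵇ-true j≤w = ≡.refl

inDiag-false : ∀ X Y w i j → ¬ (j + X ≡ i + Y × Y ≤ j × j ≤ w) → inDiag X Y w i j ≡ false
inDiag-false X Y w i j ¬diagonal with inDiag X Y w i j in e
... | true  = ⊥-elim (¬diagonal (inDiag-true⇒ X Y w i j e))
... | false = ≡.refl

inDiag-left : ∀ X Y w i j → j < Y → inDiag X Y w i j ≡ false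
inDiag-left X Y w i j j<Y = inDiag-false X Y w i j (λ (_ , Y≤j , _) → ℕₚ.<⇒≱ j<Y Y≤j)

inDiag-right : ∀ X Y w i j → w < j → inDiag X Y w i j ≡ false
inDiag-right X Y w i j w<j = inDiag-false X Y w i j (λ (_ , _ , j≤w) → ℕₚ.<⇒≱ w<j j≤w)

inDiag-column : ∀ X Y w d i → d + Y ≤ w → inDiag X Y w i (d + Y) ≡ (i ≡ᵇ d + X)
inDiag-column X Y w d i d+Y≤w with i ℕ.≟ d + X
... | yes ≡.refl rewrite ≡ᵇ-refl (d + X) = inDiag-true⇐ X Y w (d + X) (d + Y) (reorder d X Y) (ℕₚ.m≤n+m Y d) d+Y≤w
  where reorder : ∀ d X Y → (d + Y) + X ≡ (d + X) + Y
        reorder d X Y = ≡.trans (ℕₚ.+-assoc d Y X) (≡.trans (≡.cong (λ n → d + n) (ℕₚ.+-comm Y X)) (≡.sym (ℕₚ.+-assoc d X Y)))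
... | no i≢d+X rewrite ≢⇒≡ᵇ-false i≢d+X = inDiag-false X Y w i (d + Y) λ (e , _ , _) →
  i≢d+X (ℕₚ.+-cancelʳ-≡ Y i (d + X) (≡.sym (≡.trans (ℕₚ.+-assoc d X Y) (≡.trans (≡.cong (λ n → d + n) (ℕₚ.+-comm X Y))
    (≡.trans (≡.sym (ℕₚ.+-assoc d Y X)) e)))))

inDiag-shift : ∀ X Y w i j → j ≢ Y → inDiag X Y w i j ≡ inDiag (suc X) (suc Y) w i j
inDiag-shift X Y w i j j≢Y = true⇔true⇒≡ to from
  where
  to : inDiag X Y w i j ≡ true → inDiag (suc X) (suc Y) w i j ≡ true
  to e with inDiag-true⇒ X Y w i j e
  ... | eq , Y≤j , j≤w = inDiag-true⇐ (suc X) (suc Y) w i j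
    (≡.trans (ℕₚ.+-suc j X) (≡.trans (≡.cong suc eq) (≡.sym (ℕₚ.+-suc i Y)))) (ℕₚ.≤∧≢⇒< Y≤j (j≢Y ∘ ≡.sym)) j≤w
  from : inDiag (suc X) (suc Y) w i j ≡ true → inDiag X Y w i j ≡ true
  from e with inDiag-true⇒ (suc X) (suc Y) w i j e
  ... | eq , Y<j , j≤w = inDiag-true⇐ X Y w i j
    (ℕₚ.suc-injective (≡.trans (≡.sym (ℕₚ.+-suc j X)) (≡.trans eq (ℕₚ.+-suc i Y)))) (ℕₚ.<⇒≤ Y<j) j≤w

multL-column : ∀ ℓ X Y w d → d + Y ≤ w → 1 ≤ d + X → d + X ≤ ℓ → multL ℓ X Y w (d + Y) ≡ 1
multL-column ℓ X Y w d d+Y≤w 1≤d+X d+X≤ℓ = ≡.cong length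
  (≡.trans (filterᵇ-cong-local (interval 1 ℓ) (λ i _ → inDiag-column X Y w d i d+Y≤w)) (filterᵇ-≡ᵇ-interval 1≤d+X d+X≤ℓ 1≤d+X))

multL-zero : ∀ ℓ X Y w j → (∀ i → inDiag X Y w i j ≡ false) → multL ℓ X Y w j ≡ 0
multL-zero ℓ X Y w j off = ≡.cong length (filterᵇ-none (interval 1 ℓ) (λ i _ → off i))

multL-shift : ∀ ℓ X Y w j → j ≢ Y → multL ℓ X Y w j ≡ multL ℓ (suc X) (suc Y) w j
multL-shift ℓ X Y w j j≢Y = ≡.cong length (filterᵇ-cong-local (interval 1 ℓ) (λ i _ → inDiag-shift X Y w i j j≢Y))

module _ {ℓ Ψ} (ideal : IsRootIdeal ℓ Ψ) where

  open IsRootIdeal ideal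

  wall-row-⊆ : ∀ {y z r} → Wall ℓ Ψ y z → 1 ≤ y → y ≤ r → suc r ≤ z → ∀ j → Ψ r j ≡ true → Ψ (suc r) j ≡ true
  wall-row-⊆ {y} {z} {r} wall 1≤y y≤r r<z j rj∈Ψ with inΔ⁺ r j rj∈Ψ
  ... | _ , r<j , j≤ℓ = equal-count-⊆⇒⊇ (Ψ r) (Ψ (suc r)) (interval 1 ℓ) same-count row-below j
                          (∈-interval⁺ (ℕₚ.≤-trans (s≤s z≤n) r<j) j≤ℓ) rj∈Ψ
    where
    same-count : rowCount ℓ Ψ (suc r) ≡ rowCount ℓ Ψ r
    same-count = ≡.trans (wall (suc r) (ℕₚ.m≤n⇒m≤1+n y≤r) r<z) (≡.sym (wall r y≤r (ℕₚ.<⇒≤ r<z)))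
    row-below : ∀ k → k ∈ interval 1 ℓ → Ψ (suc r) k ≡ true → Ψ r k ≡ true
    row-below k k∈ e = upper (suc r) k r k e (ℕₚ.≤-trans 1≤y y≤r) (ℕₚ.n≤1+n r) ℕₚ.≤-refl (proj₂ (∈-interval⁻ k∈))

  wall-rows-≡ : ∀ {y z r} → Wall ℓ Ψ y z → 1 ≤ y → y ≤ r → suc r ≤ z → ∀ j → Ψ r j ≡ Ψ (suc r) j
  wall-rows-≡ wall 1≤y y≤r r<z j = true⇔true⇒≡ (wall-row-⊆ wall 1≤y y≤r r<z j)
    (λ e → upper _ j _ j e (ℕₚ.≤-trans 1≤y y≤r) (ℕₚ.n≤1+n _) ℕₚ.≤-refl (proj₂ (proj₂ (inΔ⁺ _ j e))))

  -- Pushing a root down the wall row by row would eventually put it on the diagonal.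
  wall-no-roots : ∀ {y z r j} → Wall ℓ Ψ y z → 1 ≤ y → y ≤ r → j ≤ z → Ψ r j ≡ false
  wall-no-roots {y} {z} {r} {j} wall 1≤y y≤r j≤z with Ψ r j in rj∈Ψ
  ... | false = ≡.refl
  ... | true with ℕₚ.m≤n⇒∃[o]m+o≡n (proj₁ (proj₂ (inΔ⁺ r j rj∈Ψ)))
  ...   | k , r+1+k≡j rewrite ≡.sym r+1+k≡j | ℕₚ.+-comm r k =
    ⊥-elim (descend k r y≤r j≤z rj∈Ψ)
    where
    descend : ∀ k r → y ≤ r → suc (k + r) ≤ z → Ψ r (suc (k + r)) ≡ true → ⊥
    descend zero    r y≤r r<z e = ℕₚ.<-irrefl ≡.refl (proj₁ (proj₂ (inΔ⁺ _ _ (wall-row-⊆ wall 1≤y y≤r r<z _ e))))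
    descend (suc k) r y≤r k+r<z e rewrite ≡.sym (ℕₚ.+-suc k r) =
      descend k (suc r) (ℕₚ.m≤n⇒m≤1+n y≤r) k+r<z
        (wall-row-⊆ wall 1≤y y≤r (ℕₚ.≤-trans (s≤s (ℕₚ.m≤n+m r (suc k))) (≡.subst (_≤ z) (≡.cong suc (ℕₚ.+-suc k r)) k+r<z)) _ e)

  ceiling-column-⊆ : ∀ {c d} → Ceiling ℓ Ψ c d → c ≤ d → d ≤ ℓ → ∀ i → Ψ i d ≡ true → Ψ i c ≡ true
  ceiling-column-⊆ {c} {d} ceiling c≤d d≤ℓ i id∈Ψ with inΔ⁺ i d id∈Ψ
  ... | 1≤i , i<d , _ = equal-count-⊆⇒⊇ (λ i → Ψ i d) (λ i → Ψ i c) (interval 1 ℓ) (≡.sym (ceiling d c≤d ℕₚ.≤-refl))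
    (λ k k∈ e → upper k c k d e (proj₁ (∈-interval⁻ k∈)) ℕₚ.≤-refl c≤d d≤ℓ) i (∈-interval⁺ 1≤i (ℕₚ.<⇒≤ (ℕₚ.<-≤-trans i<d d≤ℓ))) id∈Ψ

  -- Below a removable root (a, b) its column is empty, since Ψ ∖ (a, b) must stay an upper ideal.
  removable-column : ∀ {a b} → Removable ℓ Ψ a b → Ψ a b ≡ true → 1 ≤ a → b ≤ ℓ → ∀ i → Ψ i b ≡ true → i ≤ a
  removable-column {a} {b} removable ab∈Ψ 1≤a b≤ℓ i ib∈Ψ with i ℕ.≤? a
  ... | yes i≤a = i≤a
  ... | no  i≰a = ⊥-elim (false≢true (≡.trans (≡.sym ab∉Ψ′)
        (IsRootIdeal.upper removable (suc a) b a b a+1b∈Ψ′ 1≤a (ℕₚ.n≤1+n a) ℕₚ.≤-refl b≤ℓ)))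
    where
    a+1b∈Ψ′ : removeRoot a b Ψ (suc a) b ≡ true
    a+1b∈Ψ′ rewrite upper i b (suc a) b ib∈Ψ (s≤s z≤n) (ℕₚ.≰⇒> i≰a) ℕₚ.≤-refl b≤ℓ | ≢⇒≡ᵇ-false (ℕₚ.1+n≢n {a}) = ≡.refl
    ab∉Ψ′ : removeRoot a b Ψ a b ≡ false
    ab∉Ψ′ rewrite ab∈Ψ | ≡ᵇ-refl a | ≡ᵇ-refl b = ≡.refl

module DiagonalRemoval (ℓ : ℕ) (Ψ : RootSet) (m : ℕ → ℕ) (x y z : ℕ)
  (ideal : IsRootIdeal ℓ Ψ) (1≤x : 1 ≤ x) (x<y : x < y) (y≤z : y ≤ z) (z≤ℓ : z ≤ ℓ)
  (ceiling : Ceiling ℓ Ψ (z ∸ 1) z)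
  (D⊆Ψ : ∀ i j → inDiag x y (z ∸ 1) i j ≡ true → Ψ i j ≡ true)
  (D-removable : ∀ i j → inDiag x y (z ∸ 1) i j ≡ true → Removable ℓ Ψ i j)
  (L⊆M : ∀ j → multL ℓ x y (z ∸ 1) j ≤ m j) (m[z] : m z ≡ m (z ∸ 1))
  (m-steps : ∀ j → y ≤ j → j ≤ z ∸ 1 → m j + ((z ∸ 1) ∸ j) ≡ m (z ∸ 1))
  (wall : Wall ℓ Ψ y z) where

  open IsRootIdeal ideal

  w : ℕ
  w = z ∸ 1

  -- Ψₜ t and mₜ t have the roots (x + s, y + s), s ≥ t, of the diagonal removed; Ψₜ 0 = Ψ' and mₜ 0 = M'.
  Ψₜ : ℕ → RootSet
  Ψₜ t = removeDiag (t + x) (t + y) w Ψ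

  mₜ : ℕ → ℕ → ℕ
  mₜ t = minusL ℓ (t + x) (t + y) w m

  private
    1≤y : 1 ≤ y
    1≤y = ℕₚ.≤-trans 1≤x (ℕₚ.<⇒≤ x<y)

    1+w≡z : suc w ≡ z
    1+w≡z = ℕₚ.m+[n∸m]≡n (ℕₚ.≤-trans 1≤y y≤z)

    ≤w⇒<z : ∀ {j} → j ≤ w → j < z
    ≤w⇒<z j≤w = ≡.subst (suc _ ≤_) 1+w≡z (s≤s j≤w)

    last-column : ∀ {j} → j ≤ w → ¬ (suc j ≤ w) → suc j ≡ z
    last-column j≤w j≮w = ≡.trans (≡.cong suc (ℕₚ.≤-antisym j≤w (ℕₚ.≮⇒≥ j≮w))) 1+w≡z

    1≤t+x : ∀ t → 1 ≤ t + x
    1≤t+x t = ℕₚ.≤-trans 1≤x (ℕₚ.m≤n+m x t)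

    t+y≤ℓ : ∀ {t} → t + y ≤ w → t + y ≤ ℓ
    t+y≤ℓ t+y≤w = ℕₚ.≤-trans (ℕₚ.<⇒≤ (≤w⇒<z t+y≤w)) z≤ℓ

    t+x≤ℓ : ∀ {t} → t + y ≤ w → t + x ≤ ℓ
    t+x≤ℓ t+y≤w = ℕₚ.<⇒≤ (ℕₚ.<-≤-trans (ℕₚ.+-monoʳ-< _ x<y) (t+y≤ℓ t+y≤w))

    m-step : ∀ j → y ≤ j → suc j ≤ w → m (suc j) ≡ suc (m j)
    m-step j y≤j j<w = ℕₚ.+-cancelʳ-≡ (w ∸ suc j) _ _ (≡.sym (begin
      suc (m j) + (w ∸ suc j)  ≡⟨ ℕₚ.+-suc (m j) (w ∸ suc j) ⟨
      m j + suc (w ∸ suc j)    ≡⟨ ≡.cong (λ k → m j + k) (ℕₚ.+-∸-assoc 1 j<w) ⟨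
      m j + (w ∸ j)            ≡⟨ m-steps j y≤j (ℕₚ.<⇒≤ j<w) ⟩
      m w                      ≡⟨ m-steps (suc j) (ℕₚ.m≤n⇒m≤1+n y≤j) j<w ⟨
      m (suc j) + (w ∸ suc j)  ∎))
      where open ≡.≡-Reasoning

    diagonal-root : ∀ t → t + y ≤ w → inDiag x y w (t + x) (t + y) ≡ true
    diagonal-root t t+y≤w = ≡.trans (inDiag-column x y w t (t + x) t+y≤w) (≡ᵇ-refl (t + x))

    diagonalₜ⊆diagonal : ∀ t i j → inDiag (t + x) (t + y) w i j ≡ true → inDiag x y w i j ≡ true
    diagonalₜ⊆diagonal t i j e with inDiag-true⇒ (t + x) (t + y) w i j e
    ... | eq , t+y≤j , j≤w = inDiag-true⇐ x y w i j
      (ℕₚ.+-cancelˡ-≡ t _ _ (≡.trans (ℕ+ₚ.x∙yz≈y∙xz t j x) (≡.trans eq (ℕ+ₚ.x∙yz≈y∙xz i t y))))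
      (ℕₚ.≤-trans (ℕₚ.m≤n+m y t) t+y≤j) j≤w

    rows-off-diagonal : ∀ t i j → y ≤ i → inDiag (t + x) (t + y) w i j ≡ false
    rows-off-diagonal t i j y≤i with inDiag (t + x) (t + y) w i j in e
    ... | false = ≡.refl
    ... | true  = ⊥-elim (false≢true (≡.trans
      (≡.sym (wall-no-roots ideal wall 1≤y y≤i (ℕₚ.<⇒≤ (≤w⇒<z (proj₂ (proj₂ (inDiag-true⇒ _ _ w i j e)))))))
      (D⊆Ψ i j (diagonalₜ⊆diagonal t i j e))))

    Ψₜ-row : ∀ t r j → y ≤ r → Ψₜ t r j ≡ Ψ r j
    Ψₜ-row t r j y≤r rewrite rows-off-diagonal t r j y≤r = ∧-identityʳ (Ψ r j)

    column⇒ : ∀ t → t + y ≤ w → ∀ i → Ψ i (t + y) ≡ true → 1 ≤ i × i ≤ t + x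
    column⇒ t t+y≤w i e = proj₁ (inΔ⁺ i _ e) ,
      removable-column ideal (D-removable _ _ (diagonal-root t t+y≤w)) (D⊆Ψ _ _ (diagonal-root t t+y≤w)) (1≤t+x t) (t+y≤ℓ t+y≤w) i e

    column⇐ : ∀ t → t + y ≤ w → ∀ i → 1 ≤ i → i ≤ t + x → Ψ i (t + y) ≡ true
    column⇐ t t+y≤w i 1≤i i≤t+x = upper _ _ i _ (D⊆Ψ _ _ (diagonal-root t t+y≤w)) 1≤i i≤t+x ℕₚ.≤-refl (t+y≤ℓ t+y≤w)

    diagonalₜ-empty : ∀ t → z ≤ t + y → ∀ i j → inDiag (t + x) (t + y) w i j ≡ false
    diagonalₜ-empty t z≤t+y i j = inDiag-false _ _ w i j λ (_ , t+y≤j , j≤w) → ℕₚ.<⇒≱ (≤w⇒<z j≤w) (ℕₚ.≤-trans z≤t+y t+y≤j)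

  Ψₜ⊆Δ : ∀ t i j → Ψₜ t i j ≡ true → i < j × j ≤ ℓ
  Ψₜ⊆Δ t i j e = proj₂ (inΔ⁺ i j (∧-true⇒trueˡ e))

  Ψₜ-empty : ∀ t → z ≤ t + y → ∀ i j → Ψ i j ≡ Ψₜ t i j
  Ψₜ-empty t z≤t+y i j rewrite diagonalₜ-empty t z≤t+y i j = ≡.sym (∧-identityʳ (Ψ i j))

  mₜ-empty : ∀ t → z ≤ t + y → ∀ j → m j ≡ mₜ t j
  mₜ-empty t z≤t+y j rewrite multL-zero ℓ (t + x) (t + y) w j (λ i → diagonalₜ-empty t z≤t+y i j) = ≡.refl

  module _ {t : ℕ} (t+y≤w : t + y ≤ w) where

    private
      y≤t+y : y ≤ t + y
      y≤t+y = ℕₚ.m≤n+m y t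

      t+1+y≰w⇒t+y≡w : ¬ (suc (t + y) ≤ w) → t + y ≡ w
      t+1+y≰w⇒t+y≡w t+1+y≰w = ≡.cong ℕ.pred (last-column t+y≤w t+1+y≰w)

      Ψₜ₊₁-column : ∀ i → Ψₜ (suc t) i (t + y) ≡ Ψ i (t + y)
      Ψₜ₊₁-column i rewrite inDiag-left (suc t + x) (suc t + y) w i (t + y) (ℕₚ.n<1+n (t + y)) = ∧-identityʳ _

      next-column⇒ : ∀ i → Ψₜ (suc t) i (suc (t + y)) ≡ true → 1 ≤ i × i ≤ t + x
      next-column⇒ i e with suc (t + y) ℕ.≤? w
      ... | yes t+1+y≤w rewrite inDiag-column (suc t + x) (suc t + y) w 0 i t+1+y≤w with i ℕ.≟ suc (t + x)
      ...   | yes ≡.refl rewrite ≡ᵇ-refl (t + x) | ∧-zeroʳ (Ψ (suc (t + x)) (suc (t + y))) = ⊥-elim (false≢true e)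
      ...   | no i≢t+1+x with column⇒ (suc t) t+1+y≤w i (∧-true⇒trueˡ e)
      ...     | 1≤i , i≤t+1+x = 1≤i , ℕₚ.≤-pred (ℕₚ.≤∧≢⇒< i≤t+1+x i≢t+1+x)
      next-column⇒ i e | no t+1+y≰w = column⇒ t t+y≤w i (≡.subst (λ c → Ψ i c ≡ true) (≡.sym (t+1+y≰w⇒t+y≡w t+1+y≰w))
        (ceiling-column-⊆ ideal ceiling (ℕₚ.m∸n≤m z 1) z≤ℓ i (≡.subst (λ c → Ψ i c ≡ true) (last-column t+y≤w t+1+y≰w) (∧-true⇒trueˡ e))))

      next-column⇐ : ∀ i → 1 ≤ i → i ≤ t + x → Ψₜ (suc t) i (suc (t + y)) ≡ true
      next-column⇐ i 1≤i i≤t+x with suc (t + y) ℕ.≤? w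
      ... | yes t+1+y≤w rewrite inDiag-column (suc t + x) (suc t + y) w 0 i t+1+y≤w | ≢⇒≡ᵇ-false (ℕₚ.<⇒≢ (s≤s i≤t+x))
                              | column⇐ (suc t) t+1+y≤w i 1≤i (ℕₚ.m≤n⇒m≤1+n i≤t+x) = ≡.refl
      ... | no t+1+y≰w rewrite inDiag-right (suc t + x) (suc t + y) w i (suc (t + y)) (ℕₚ.≰⇒> t+1+y≰w) =
        ≡.trans (∧-identityʳ _) (upper i (t + y) i (suc (t + y)) (column⇐ t t+y≤w i 1≤i i≤t+x) 1≤i ℕₚ.≤-refl (ℕₚ.n≤1+n _)
          (≡.subst (_≤ ℓ) (≡.sym (last-column t+y≤w t+1+y≰w)) z≤ℓ))

      Ψₜ₊₁-columns : ∀ i → Ψₜ (suc t) i (t + y) ≡ Ψₜ (suc t) i (suc (t + y))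
      Ψₜ₊₁-columns i = ≡.trans (Ψₜ₊₁-column i) (true⇔true⇒≡
        (λ e → let (1≤i , i≤t+x) = column⇒ t t+y≤w i e in next-column⇐ i 1≤i i≤t+x)
        (λ e → let (1≤i , i≤t+x) = next-column⇒ i e in column⇐ t t+y≤w i 1≤i i≤t+x))

      Ψₜ₊₁-rows : ∀ j → Ψₜ (suc t) (t + y) j ≡ Ψₜ (suc t) (suc (t + y)) j
      Ψₜ₊₁-rows j = ≡.trans (Ψₜ-row (suc t) _ j y≤t+y)
        (≡.trans (wall-rows-≡ ideal wall 1≤y y≤t+y (≤w⇒<z t+y≤w) j) (≡.sym (Ψₜ-row (suc t) _ j (ℕₚ.m≤n⇒m≤1+n y≤t+y))))

      multLₜ₊₁-column : multL ℓ (suc t + x) (suc t + y) w (t + y) ≡ 0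
      multLₜ₊₁-column = multL-zero ℓ (suc t + x) (suc t + y) w (t + y) (λ i → inDiag-left _ _ w i _ (ℕₚ.n<1+n (t + y)))

    rootₜ∈Ψₜ₊₁ : Ψₜ (suc t) (t + x) (t + y) ≡ true
    rootₜ∈Ψₜ₊₁ = ≡.trans (Ψₜ₊₁-column (t + x)) (D⊆Ψ _ _ (diagonal-root t t+y≤w))

    Ψₜ₊₁-transpose-invariant : ∀ i j → Ψₜ (suc t) (transpose (t + y) i) (transpose (t + y) j) ≡ Ψₜ (suc t) i j
    Ψₜ₊₁-transpose-invariant = transpose-invariant (Ψₜ (suc t)) (t + y) Ψₜ₊₁-rows Ψₜ₊₁-columns

    removeRoot-Ψₜ₊₁ : ∀ i j → removeRoot (t + x) (t + y) (Ψₜ (suc t)) i j ≡ Ψₜ t i j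
    removeRoot-Ψₜ₊₁ i j with j ℕ.≟ t + y
    ... | yes ≡.refl rewrite inDiag-left (suc t + x) (suc t + y) w i (t + y) (ℕₚ.n<1+n (t + y))
                           | inDiag-column (t + x) (t + y) w 0 i t+y≤w | ≡ᵇ-refl (t + y) with i ≡ᵇ t + x | Ψ i (t + y)
    ...   | true  | true  = ≡.refl
    ...   | true  | false = ≡.refl
    ...   | false | true  = ≡.refl
    ...   | false | false = ≡.refl
    removeRoot-Ψₜ₊₁ i j | no j≢t+y rewrite ≢⇒≡ᵇ-false j≢t+y | ∧-zeroʳ (i ≡ᵇ t + x) | inDiag-shift (t + x) (t + y) w i j j≢t+y =
      ∧-identityʳ _

    mₜ₊₁-other : ∀ j → j ≢ t + y → mₜ (suc t) j ≡ mₜ t j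
    mₜ₊₁-other j j≢t+y = ≡.cong (m j ∸_) (≡.sym (multL-shift ℓ (t + x) (t + y) w j j≢t+y))

    mₜ₊₁-column : mₜ (suc t) (t + y) ≡ suc (mₜ t (t + y))
    mₜ₊₁-column rewrite multLₜ₊₁-column | multL-column ℓ (t + x) (t + y) w 0 t+y≤w (1≤t+x t) (t+x≤ℓ t+y≤w) =
      ≡.sym (ℕₚ.m+[n∸m]≡n (≡.subst (_≤ m (t + y)) (multL-column ℓ x y w t t+y≤w (1≤t+x t) (t+x≤ℓ t+y≤w)) (L⊆M (t + y))))

    mₜ₊₁-next-column : mₜ (suc t) (suc (t + y)) ≡ mₜ (suc t) (t + y)
    mₜ₊₁-next-column with suc (t + y) ℕ.≤? w
    ... | yes t+1+y≤w rewrite multL-column ℓ (suc t + x) (suc t + y) w 0 t+1+y≤w (1≤t+x (suc t)) (t+x≤ℓ t+1+y≤w)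
                            | multLₜ₊₁-column | m-step (t + y) y≤t+y t+1+y≤w = ≡.refl
    ... | no t+1+y≰w = begin
      mₜ (suc t) (suc (t + y))  ≡⟨ ≡.cong (mₜ (suc t)) (last-column t+y≤w t+1+y≰w) ⟩
      mₜ (suc t) z              ≡⟨ ≡.cong (m z ∸_) (multL-zero ℓ (suc t + x) (suc t + y) w z (λ i → inDiag-right _ _ w i z (≤w⇒<z ℕₚ.≤-refl))) ⟩
      m z                       ≡⟨ m[z] ⟩
      m w                       ≡⟨ ≡.cong m (t+1+y≰w⇒t+y≡w t+1+y≰w) ⟨
      m (t + y)                 ≡⟨ ≡.cong (m (t + y) ∸_) multLₜ₊₁-column ⟨
      mₜ (suc t) (t + y)        ∎
      where open ≡.≡-Reasoning

  module _ {c r : Level} (R : CommutativeRing c r) (h : ℕ → CommutativeRing.Carrier R)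
           (γ : Exponent) (γ-const : ∀ t → y ≤ t → t ≤ z → γ t ≡ γ y) where

    open CommutativeRing R using (_≈_; trans)
    open Sym R h using (Ktrunc)

    Ktrunc-removeDiagonalRoot : ∀ {t} → t + y ≤ w →
      ∃ λ N₀ → ∀ N → N₀ ≤ N → Ktrunc ℓ N (Ψₜ (suc t)) (mₜ (suc t)) γ ≈ Ktrunc ℓ N (Ψₜ t) (mₜ t) γ
    Ktrunc-removeDiagonalRoot {t} t+y≤w =
      proj₁ removal , λ N N₀≤N → trans (proj₂ removal N N₀≤N) (Ktrunc-cong R h ℓ N (removeRoot-Ψₜ₊₁ t+y≤w) (λ _ → ≡.refl) γ)
      where
      y≤t+y : y ≤ t + y
      y≤t+y = ℕₚ.m≤n+m y t
      γ-equal : γ (t + y) ≡ γ (suc (t + y))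
      γ-equal = ≡.trans (γ-const _ y≤t+y (ℕₚ.<⇒≤ (≤w⇒<z t+y≤w))) (≡.sym (γ-const _ (ℕₚ.m≤n⇒m≤1+n y≤t+y) (≤w⇒<z t+y≤w)))
      removal : ∃ λ N₀ → ∀ N → N₀ ≤ N →
        Ktrunc ℓ N (Ψₜ (suc t)) (mₜ (suc t)) γ ≈ Ktrunc ℓ N (removeRoot (t + x) (t + y) (Ψₜ (suc t))) (mₜ t) γ
      removal = Ktrunc-removeRoot R h ℓ (Ψₜ (suc t)) (t + x) (t + y) (1≤t+x t) (ℕₚ.+-monoʳ-< t x<y) (t+y≤ℓ t+y≤w)
        (Ψₜ⊆Δ (suc t)) (rootₜ∈Ψₜ₊₁ t+y≤w) (mₜ (suc t)) (mₜ t) γ (ℕₚ.<-≤-trans (≤w⇒<z t+y≤w) z≤ℓ)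
        (Ψₜ₊₁-transpose-invariant t+y≤w) (mₜ₊₁-next-column t+y≤w) (mₜ₊₁-column t+y≤w) (mₜ₊₁-other t+y≤w) γ-equal

    -- The roots are removed from the top of the diagonal (column z - 1) downwards.
    Ktrunc-removeDiagonal : ∀ d t → d + (t + y) ≡ z →
      ∃ λ N₀ → ∀ N → N₀ ≤ N → Ktrunc ℓ N Ψ m γ ≈ Ktrunc ℓ N (Ψₜ t) (mₜ t) γ
    Ktrunc-removeDiagonal zero    t t+y≡z =
      0 , λ N _ → Ktrunc-cong R h ℓ N (Ψₜ-empty t (ℕₚ.≤-reflexive (≡.sym t+y≡z))) (mₜ-empty t (ℕₚ.≤-reflexive (≡.sym t+y≡z))) γ
    Ktrunc-removeDiagonal (suc d) t d+1+t+y≡z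
      with Ktrunc-removeDiagonal d (suc t) (≡.trans (ℕₚ.+-suc d (t + y)) d+1+t+y≡z) | Ktrunc-removeDiagonalRoot t+y≤w
      where
      t+y≤w : t + y ≤ w
      t+y≤w = ℕₚ.≤-pred (≡.subst (suc (t + y) ≤_) (≡.trans d+1+t+y≡z (≡.sym 1+w≡z)) (s≤s (ℕₚ.m≤n+m (t + y) d)))
    ... | N₁ , upper-removed | N₂ , root-removed = N₁ ⊔ N₂ , λ N N₁⊔N₂≤N →
      trans (upper-removed N (ℕₚ.≤-trans (ℕₚ.m≤m⊔n N₁ N₂) N₁⊔N₂≤N)) (root-removed N (ℕₚ.≤-trans (ℕₚ.m≤n⊔m N₁ N₂) N₁⊔N₂≤N))

lemma4p13 : {c r : Level} (R : CommutativeRing c r) (h : ℕ → CommutativeRing.Carrier R) →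
    CommutativeRing._≈_ R (h 0) (CommutativeRing.1# R) →
    (ℓ : ℕ) (Ψ : RootSet) (m : ℕ → ℕ) (γ : ℕ → ℤ) (x y z : ℕ) →
    IsRootIdeal ℓ Ψ → MultisetOn ℓ m →
    1 ≤ x → x < y → y ≤ z → z ≤ ℓ →
    -- (a)
    Ceiling ℓ Ψ (z ∸ 1) z →
    (∀ i j → inDiag x y (z ∸ 1) i j ≡ true → Ψ i j ≡ true) →
    (∀ i j → inDiag x y (z ∸ 1) i j ≡ true → Removable ℓ Ψ i j) →
    -- (b)
    (∀ j → multL ℓ x y (z ∸ 1) j ≤ m j) →
    m z ≡ m (z ∸ 1) →
    (∀ j → y ≤ j → j ≤ z ∸ 1 → m j + ((z ∸ 1) ∸ j) ≡ m (z ∸ 1)) →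
    -- (c)
    Wall ℓ Ψ y z →
    -- (d)
    (∀ t → y ≤ t → t ≤ z → γ t ≡ γ y) →
    -- conclusion: K(Ψ;M;γ) = K(Ψ';M';γ)
    ∃ λ N₀ → ∀ N → N₀ ≤ N →
      CommutativeRing._≈_ R (Sym.Ktrunc R h ℓ N Ψ m γ)
        (Sym.Ktrunc R h ℓ N (removeDiag x y (z ∸ 1) Ψ) (minusL ℓ x y (z ∸ 1) m) γ)
lemma4p13 R h _ ℓ Ψ m γ x y z ideal _ 1≤x x<y y≤z z≤ℓ ceiling D⊆Ψ D-removable L⊆M m[z] m-steps wall γ-const =
  Ktrunc-removeDiagonal R h γ γ-const (z ∸ y) 0 (ℕₚ.m∸n+n≡m y≤z)
  where open DiagonalRemoval ℓ Ψ m x y z ideal 1≤x x<y y≤z z≤ℓ ceiling D⊆Ψ D-removable L⊆M m[z] m-steps wall
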